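{- Let $F$ be a finite field of characteristic $p$ and order $q=p^n$, let $\mathrm{Tr}\colon F\to\mathbb{F}_p$ be the absolute trace, let $\epsilon\colon\mathbb{F}_p\to\mathbb{C}$, $\epsilon(x)=\exp(2\pi i x/p)$, and let $\psi=\epsilon\circ\mathrm{Tr}$ be the canonical additive character of $F$. Let $d=2+p^r$ for a nonnegative integer $r$ with $\gcd(d,q-1)=1$, and let $W_{F,d}(a)=\sum_{x\in F}\psi(x^d-ax)$ for $a\in F$. For $x\in F$ write $\bar x=x^{p^r}$, and define the symmetric $\mathbb{F}_p$-trilinear form \[ T(x,y,z)=\mathrm{Tr}(\bar x y z + x\bar y z + x y\bar z)\qquad(x,y,z\in F). \] Then \[ \sum_{a\in F^\times} W_{F,d}(a)^4 = q\sum_{x,y,z\in F}\epsilon\bigl(T(x,y,x)+T(x,y,y)+2T(x,y,z)\bigr). \]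
   Context: $F^\times$ denotes the set of nonzero elements of $F$. -}

module Defs where

open import Level using (0ℓ) renaming (suc to lsuc)
open import Data.Nat as ℕ using (ℕ; zero; suc; NonZero; _%_)
open import Data.Nat.Primality using (Prime; prime⇒nonZero)
open import Data.Integer as ℤ using (ℤ; +_)
open import Data.Fin using (Fin; toℕ; fromℕ<)
open import Data.Nat.DivMod using (m%n<n)
open import Data.List using (List; []; _∷_; foldr; map; allFin; filter; length; upTo)
open import Data.List.Membership.Propositional using (_∈_)
open import Data.List.Relation.Unary.Unique.Propositional using (Unique)
open import Data.Product using (Σ; ∃; _×_)
open import Relation.Binary.PropositionalEquality using (_≡_; _≢_)
open import Relation.Binary.Definitions using (DecidableEquality)
open import Relation.Nullary using (¬_; yes; no)
open import Relation.Nullary.Decidable using (does)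
open import Algebra.Core using (Op₁; Op₂)
open import Algebra.Structures using (IsCommutativeRing)

record FiniteField : Set₁ where
  field
    Carrier : Set
    _+_ _*_ : Op₂ Carrier
    -_      : Op₁ Carrier
    0# 1#   : Carrier
    isCommutativeRing : IsCommutativeRing _≡_ _+_ _*_ -_ 0# 1#
    0≢1     : 0# ≢ 1#
    inverse : ∀ x → x ≢ 0# → ∃ λ y → x * y ≡ 1#
    _≟_     : DecidableEquality Carrier
    elements : List Carrier
    complete : ∀ x → x ∈ elements
    unique   : Unique elements

  infixl 6 _+_
  infixl 7 _*_

  size : ℕ
  size = length elements

  _×1 : ℕ → Carrier
  zero ×1 = 0#
  suc k ×1 = 1# + k ×1

  _^_ : Carrier → ℕ → Carrier
  x ^ zero = 1#
  x ^ suc k = x * (x ^ k)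

  _-_ : Op₂ Carrier
  x - y = x + (- y)

  sumF : List Carrier → Carrier
  sumF = foldr _+_ 0#

  units : List Carrier
  units = filter (λ x → Relation.Nullary.¬? (x ≟ 0#)) elements

open FiniteField public using (Carrier)

card : FiniteField → ℕ
card = FiniteField.size

elems : (F : FiniteField) → List (Carrier F)
elems = FiniteField.elements

elemsˣ : (F : FiniteField) → List (Carrier F)
elemsˣ = FiniteField.units

-- p · 1 = 0 in F (together with p prime: F has characteristic p)
HasChar : (F : FiniteField) → ℕ → Set
HasChar F p = p F.×1 ≡ F.0#
  where module F = FiniteField F

-- The ring ℤ[ζ_p] ⊂ ℂ, ζ_p = exp(2πi/p).
-- An element is a coefficient vector c : Fin p → ℤ standing for the
-- complex number  Σ_j c j · ζ_p^j.  Since the minimal polynomial of ζ_p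
-- is 1 + x + … + x^(p-1) (p prime), two such vectors denote the same
-- complex number iff their difference is a constant vector; that is the
-- equality _≈ᶜ_ below (= equality in ℂ).

Cyc : ℕ → Set
Cyc p = Fin p → ℤ

module _ {p : ℕ} where

  _≈ᶜ_ : Cyc p → Cyc p → Set
  u ≈ᶜ v = Σ ℤ λ c → ∀ j → u j ℤ.- v j ≡ c

  0ᶜ : Cyc p
  0ᶜ _ = + 0

  _+ᶜ_ : Cyc p → Cyc p → Cyc p
  (u +ᶜ v) j = u j ℤ.+ v j

  sumᶜ : {A : Set} → (A → Cyc p) → List A → Cyc p
  sumᶜ f xs = foldr (λ x acc → f x +ᶜ acc) 0ᶜ xs

  _·ᶜ_ : ℕ → Cyc p → Cyc p
  (k ·ᶜ u) j = + k ℤ.* u j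

module _ {p : ℕ} {{_ : NonZero p}} where

  private
    sumℤ : List ℤ → ℤ
    sumℤ = foldr ℤ._+_ (+ 0)

  -- product: ζ^i · ζ^j = ζ^((i+j) mod p)
  _*ᶜ_ : Cyc p → Cyc p → Cyc p
  (u *ᶜ v) k = sumℤ (map (λ i → sumℤ (map (λ j →
      if does (((toℕ i ℕ.+ toℕ j) % p) ℕ.≟ toℕ k) then u i ℤ.* v j else + 0)
      (allFin p))) (allFin p))
    where open import Data.Bool using (if_then_else_)

  _^4 : Cyc p → Cyc p
  u ^4 = u *ᶜ (u *ᶜ (u *ᶜ u))

  ε : ℕ → Cyc p
  ε k j = if does (toℕ j ℕ.≟ k % p) then + 1 else + 0
    where open import Data.Bool using (if_then_else_)

module _ (F : FiniteField) where
  open FiniteField F hiding (Carrier)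

  TrF : (p n : ℕ) → Carrier F → Carrier F
  TrF p n x = sumF (map (λ i → x ^ (p ℕ.^ i)) (upTo n))

  -- identification of the prime subfield {k·1} with 𝔽_p = Fin p:
  -- the least k < p with k·1 = t (default 0, never used when t is in
  -- the prime field).
  toFp : (p : ℕ) {{_ : NonZero p}} → Carrier F → Fin p
  toFp p {{nz}} t = go (allFin p)
    where
      go : List (Fin p) → Fin p
      go [] = fromℕ< (m%n<n 0 p)
      go (k ∷ ks) with (toℕ k ×1) ≟ t
      ... | yes _ = k
      ... | no _  = go ks

  Tr : (p n : ℕ) {{_ : NonZero p}} → Carrier F → Fin p
  Tr p n x = toFp p (TrF p n x)

  ψ : (p n : ℕ) {{_ : NonZero p}} → Carrier F → Cyc p
  ψ p n x = ε (toℕ (Tr p n x))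

  W : (p n d : ℕ) {{_ : NonZero p}} → Carrier F → Cyc p
  W p n d a = sumᶜ (λ x → ψ p n ((x ^ d) - (a * x))) elements

  bar : (p r : ℕ) → Carrier F → Carrier F
  bar p r x = x ^ (p ℕ.^ r)

  T : (p n r : ℕ) {{_ : NonZero p}} → Carrier F → Carrier F → Carrier F → Fin p
  T p n r x y z =
    Tr p n (bar p r x * y * z + x * bar p r y * z + x * y * bar p r z)

-- a prime is nonzero (lets instance search supply NonZero p from Prime p)
instance
  prime⇒nonZero-inst : {p : ℕ} {{_ : Prime p}} → NonZero p
  prime⇒nonZero-inst {{pp}} = prime⇒nonZero pp

module Submission where

-- Since gcd(d, q - 1) = 1, x ↦ x^d permutes F, so W(0) = Σ_x ψ(x) = 0 and the sum may run over all of F.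
-- Expanding W(a)^4 and summing over a, orthogonality of characters leaves q times the sum of
-- ψ(x₁^d + x₂^d + x₃^d + x₄^d) over x₁ + x₂ + x₃ + x₄ = 0.  Writing x^d = x² x̄ with x ↦ x̄ additive and
-- substituting (x₁, x₂, x₃) = (z, -z-x, -z-y), that argument becomes T(x,y,x) + T(x,y,y) + 2T(x,y,z).
-- Σ_x ψ(x) = 0 because Tr takes values in the prime field and is not identically zero (both by counting
-- roots of polynomials), so translating by an element of trace 1 multiplies the sum by ζ.

open import Defs
open import Algebra.Bundles using (CommutativeRing; CommutativeSemigroup)
open import Algebra.Core using (Op₂)
import Algebra.Properties.CommutativeSemigroup as CommutativeSemigroupProperties
import Algebra.Properties.CommutativeSemiring.Binomial as Binomial
import Algebra.Properties.Monoid.Sum as MonoidSum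
import Algebra.Properties.Ring as RingProperties
import Algebra.Properties.Semiring.Exp as SemiringExp
import Algebra.Properties.Semiring.Mult as SemiringMult
import Algebra.Solver.Ring as RingSolver
import Algebra.Solver.Ring.AlmostCommutativeRing as ACR
open import Algebra.Structures using (IsCommutativeMonoid)
open import Data.Bool using (if_then_else_)
open import Data.Empty using (⊥; ⊥-elim)
open import Data.Fin as Fin using (Fin; toℕ; fromℕ; fromℕ<)
import Data.Fin.Properties as Fin
open import Data.Integer as ℤ using (ℤ; -[1+_]; +[1+_])
import Data.Integer.Properties as ℤ
import Data.Integer.Solver as ℤ-Solver
open import Data.List using (List; []; _∷_; _++_; map; foldr; filter; length; allFin; upTo)
import Data.List.Properties as List
open import Data.List.Membership.Propositional using (_∈_)
open import Data.List.Membership.Propositional.Properties using (∈-allFin; ∈-filter⁺; ∈-filter⁻; ∈-map⁻)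
import Data.List.Membership.DecPropositional as DecMembership
open import Data.List.Relation.Unary.All as All using (All; all?)
open import Data.List.Relation.Unary.All.Properties using (All¬⇒¬Any; ¬All⇒Any¬)
open import Data.List.Relation.Unary.AllPairs using (_∷_)
open import Data.List.Relation.Unary.Any as Any using (here; there)
open import Data.List.Relation.Unary.Unique.Propositional using (Unique)
import Data.List.Relation.Unary.Unique.Propositional.Properties as Unique
import Data.Maybe as Maybe
open import Data.Nat as ℕ using (ℕ; zero; suc; NonZero; z≤n; s≤s; _%_; _∸_)
open import Data.Nat.Base using (_!)
import Data.Nat.Properties as ℕ
open import Data.Nat.Combinatorics using (_C_; nCn≡1; nCk≡n!/k![n-k]!; k![n∸k]!∣n!)
open import Data.Nat.Coprimality as Coprime using (Coprime; coprime-Bézout; gcd≡1⇒coprime)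
open import Data.Nat.DivMod
  using (_/_; m%n<n; m%n%n≡m%n; m≡m%n+[m/n]*n; m/n*n≡m; m<n⇒m%n≡m; [m+n]%n≡m%n; [m+kn]%n≡m%n; %-distribˡ-+; %-distribˡ-*)
open import Data.Nat.Divisibility using (_∣_; divides; n∣m*n; m∣m*n; ∣⇒≤)
open import Data.Nat.GCD using (gcd; module Bézout)
open import Data.Nat.Primality using (Prime; prime⇒nonTrivial; euclidsLemma)
import Data.Nat.Solver as ℕ-Solver
open import Data.Product using (Σ; ∃; ∃₂; _×_; _,_; proj₁; proj₂)
open import Data.Sum using (_⊎_; inj₁; inj₂)
open import Data.Vec using (Vec; []; _∷_)
open import Data.Vec.Functional using (replicate)
open import Function using (_∘_)
open import Level using (0ℓ)
open import Relation.Binary.Bundles using (Setoid)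
open import Relation.Binary.Definitions using (DecidableEquality; tri<; tri≈; tri>)
open import Relation.Binary.PropositionalEquality
import Relation.Binary.Reasoning.Setoid as SetoidReasoning
open import Relation.Binary.Structures using (IsEquivalence)
open import Relation.Nullary using (¬_; Dec; yes; no; does; ¬?)
open import Relation.Nullary.Decidable using (dec-true; dec-false; dec⇒maybe)

-- Stated without subtraction: e is an inverse of d modulo N.
coprime⇒invertible : ∀ {d N} .{{_ : NonZero d}} → Coprime d N →
                     ∃₂ λ e m → d ℕ.* e ≡ suc (m ℕ.* N)
coprime⇒invertible {d} {N} cop with coprime-Bézout cop
... | Bézout.+- x y eq = x , y , trans (ℕ.*-comm d x) (sym eq)
... | Bézout.-+ x y eq = negate N y eq
  where
  open ℕ-Solver.+-*-Solver
  open import Data.Nat using (_+_; _*_)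
  -- From 1 + x d = y N, the inverse is -x, represented by x (N - 1).
  negate : ∀ N y → suc (x * d) ≡ y * N → ∃₂ λ e m → d * e ≡ suc (m * N)
  negate zero y eq = ⊥-elim (ℕ.1+n≢0 (trans eq (ℕ.*-zeroʳ y)))
  negate (suc zero) y eq = 1 , ℕ.pred d ,
    trans (ℕ.*-identityʳ d) (trans (sym (ℕ.suc-pred d)) (cong suc (sym (ℕ.*-identityʳ _))))
  negate (suc (suc U)) zero eq = ⊥-elim (ℕ.1+n≢0 eq)
  negate (suc (suc U)) (suc y) eq = x * suc U , y * suc U + U , ℕ.+-cancelʳ-≡ (suc U) _ _ (begin
    d * (x * suc U) + suc U         ≡⟨ solve 3 (λ d x U → d :* (x :* (con 1 :+ U)) :+ (con 1 :+ U)
                                                   := (con 1 :+ x :* d) :* (con 1 :+ U)) refl d x U ⟩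
    suc (x * d) * suc U             ≡⟨ cong (_* suc U) eq ⟩
    suc y * suc (suc U) * suc U     ≡⟨ solve 2 (λ y U → (con 1 :+ y) :* (con 2 :+ U) :* (con 1 :+ U)
                                                   := con 1 :+ (y :* (con 1 :+ U) :+ U) :* (con 2 :+ U) :+ (con 1 :+ U)) refl y U ⟩
    suc ((y * suc U + U) * suc (suc U)) + suc U ∎)
    where open ≡-Reasoning

-- Finite sums over lists

module ListSum {A : Set} {_∙_ : Op₂ A} {e : A} (isCM : IsCommutativeMonoid _≡_ _∙_ e) where
  open IsCommutativeMonoid isCM using (assoc; comm; identityˡ; identityʳ; isCommutativeSemigroup)

  private
    commutativeSemigroup : CommutativeSemigroup 0ℓ 0ℓ
    commutativeSemigroup = record { isCommutativeSemigroup = isCommutativeSemigroup }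

  open CommutativeSemigroupProperties commutativeSemigroup using (interchange)

  sum : {X : Set} → (X → A) → List X → A
  sum f []       = e
  sum f (x ∷ xs) = f x ∙ sum f xs

  sum-cong : {X : Set} {f g : X → A} (xs : List X) → (∀ x → x ∈ xs → f x ≡ g x) → sum f xs ≡ sum g xs
  sum-cong []       f≡g = refl
  sum-cong (x ∷ xs) f≡g = cong₂ _∙_ (f≡g x (here refl)) (sum-cong xs (λ y → f≡g y ∘ there))

  sum-cong′ : {X : Set} {f g : X → A} (xs : List X) → (∀ x → f x ≡ g x) → sum f xs ≡ sum g xs
  sum-cong′ xs f≡g = sum-cong xs (λ x _ → f≡g x)

  sum-zero : {X : Set} {f : X → A} (xs : List X) → (∀ x → x ∈ xs → f x ≡ e) → sum f xs ≡ e
  sum-zero []       f≡e = refl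
  sum-zero (x ∷ xs) f≡e = trans (cong₂ _∙_ (f≡e x (here refl)) (sum-zero xs (λ y → f≡e y ∘ there))) (identityˡ e)

  sum-∙ : {X : Set} (f g : X → A) (xs : List X) → sum (λ x → f x ∙ g x) xs ≡ sum f xs ∙ sum g xs
  sum-∙ f g []       = sym (identityˡ e)
  sum-∙ f g (x ∷ xs) = trans (cong (_ ∙_) (sum-∙ f g xs)) (interchange (f x) (g x) (sum f xs) (sum g xs))

  sum-swap : {X Y : Set} (h : X → Y → A) (xs : List X) (ys : List Y) →
             sum (λ x → sum (h x) ys) xs ≡ sum (λ y → sum (λ x → h x y) xs) ys
  sum-swap h []       ys = sym (sum-zero ys (λ _ _ → refl))
  sum-swap h (x ∷ xs) ys = trans (cong (sum (h x) ys ∙_) (sum-swap h xs ys))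
                                 (sym (sum-∙ (h x) (λ y → sum (λ x → h x y) xs) ys))

  sum-map : {X Y : Set} (f : Y → A) (σ : X → Y) (xs : List X) → sum f (map σ xs) ≡ sum (f ∘ σ) xs
  sum-map f σ []       = refl
  sum-map f σ (x ∷ xs) = cong (f (σ x) ∙_) (sum-map f σ xs)

  sum-++ : {X : Set} (f : X → A) (xs ys : List X) → sum f (xs ++ ys) ≡ sum f xs ∙ sum f ys
  sum-++ f []       ys = sym (identityˡ _)
  sum-++ f (x ∷ xs) ys = trans (cong (f x ∙_) (sum-++ f xs ys)) (sym (assoc _ _ _))

  foldr-map : {X : Set} (f : X → A) (xs : List X) → foldr _∙_ e (map f xs) ≡ sum f xs
  foldr-map f []       = refl
  foldr-map f (x ∷ xs) = cong (f x ∙_) (foldr-map f xs)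

  sum-single : {X : Set} {f : X → A} {x₀ : X} {xs : List X} → Unique xs → x₀ ∈ xs →
               (∀ x → x ∈ xs → x ≢ x₀ → f x ≡ e) → sum f xs ≡ f x₀
  sum-single {xs = x ∷ xs} (x∉xs ∷ _) (here refl) f≡e =
    trans (cong (_ ∙_) (sum-zero xs (λ y y∈ → f≡e y (there y∈) (λ { refl → All¬⇒¬Any x∉xs y∈ })))) (identityʳ _)
  sum-single {xs = x ∷ xs} (x∉xs ∷ u) (there x₀∈) f≡e =
    trans (cong₂ _∙_ (f≡e x (here refl) (λ { refl → All¬⇒¬Any x∉xs x₀∈ })) (sum-single u x₀∈ (λ y → f≡e y ∘ there)))
          (identityˡ _)

  -- Each term of Σ g∘σ is written as a sum of Kronecker deltas δ(y, σ x) g y; swapping the two sums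
  -- and evaluating the inner one at y = σ (τ y) gives Σ g.
  sum-reindex : {X : Set} → DecidableEquality X → {xs : List X} → Unique xs →
                (σ τ : X → X) → (∀ x → x ∈ xs → σ x ∈ xs) → (∀ y → y ∈ xs → τ y ∈ xs) →
                (∀ x → x ∈ xs → τ (σ x) ≡ x) → (∀ y → y ∈ xs → σ (τ y) ≡ y) →
                (g : X → A) → sum (g ∘ σ) xs ≡ sum g xs
  sum-reindex {X} _≟_ {xs} u σ τ σ∈ τ∈ τσ στ g = begin
    sum (g ∘ σ) xs                            ≡⟨ sum-cong xs (λ x x∈ → trans (sum-single u (σ∈ x x∈) (λ y _ → δ-off)) (δ-on refl)) ⟨
    sum (λ x → sum (λ y → δ y (σ x)) xs) xs   ≡⟨ sum-swap (λ x y → δ y (σ x)) xs xs ⟩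
    sum (λ y → sum (λ x → δ y (σ x)) xs) xs   ≡⟨ sum-cong xs (λ y y∈ → trans (sum-single u (τ∈ y y∈) (only-τy y)) (δ-on (sym (στ y y∈)))) ⟩
    sum g xs                                  ∎
    where
    open ≡-Reasoning
    δ : X → X → A
    δ y z with y ≟ z
    ... | yes _ = g y
    ... | no  _ = e
    δ-off : ∀ {y z} → y ≢ z → δ y z ≡ e
    δ-off {y} {z} y≢z with y ≟ z
    ... | yes y≡z = ⊥-elim (y≢z y≡z)
    ... | no  _   = refl
    δ-on : ∀ {y z} → y ≡ z → δ y z ≡ g y
    δ-on {y} {z} y≡z with y ≟ z
    ... | yes _   = refl
    ... | no  y≢z = ⊥-elim (y≢z y≡z)
    only-τy : ∀ y x → x ∈ xs → x ≢ τ y → δ y (σ x) ≡ e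
    only-τy y x x∈ x≢τy = δ-off (λ y≡σx → x≢τy (trans (sym (τσ x x∈)) (cong τ (sym y≡σx))))

  sum-bijection : {X : Set} → DecidableEquality X → {xs : List X} → Unique xs → (∀ x → x ∈ xs) →
                  (σ τ : X → X) → (∀ x → τ (σ x) ≡ x) → (∀ y → σ (τ y) ≡ y) →
                  (g : X → A) → sum (g ∘ σ) xs ≡ sum g xs
  sum-bijection _≟_ u all σ τ τσ στ =
    sum-reindex _≟_ u σ τ (λ x _ → all (σ x)) (λ y _ → all (τ y)) (λ x _ → τσ x) (λ y _ → στ y)

  sum-upTo-∷ʳ : (g : ℕ → A) (n : ℕ) → sum g (upTo (suc n)) ≡ sum g (upTo n) ∙ g n
  sum-upTo-∷ʳ g n = begin
    sum g (upTo (suc n))             ≡⟨ cong (sum g) (List.upTo-∷ʳ n) ⟨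
    sum g (upTo n ++ n ∷ [])         ≡⟨ sum-++ g (upTo n) (n ∷ []) ⟩
    sum g (upTo n) ∙ (g n ∙ e)       ≡⟨ cong (sum g (upTo n) ∙_) (identityʳ (g n)) ⟩
    sum g (upTo n) ∙ g n             ∎
    where open ≡-Reasoning

  sum-upTo-suc : (g : ℕ → A) (n : ℕ) → sum g (upTo (suc n)) ≡ g 0 ∙ sum (g ∘ suc) (upTo n)
  sum-upTo-suc g n = cong (g 0 ∙_) (trans (cong (sum g) (sym (List.map-upTo suc n))) (sum-map g suc (upTo n)))

  sum-upTo-rotate : (g : ℕ → A) (n : ℕ) → g n ≡ g 0 → sum (g ∘ suc) (upTo n) ≡ sum g (upTo n)
  sum-upTo-rotate g zero    _      = refl
  sum-upTo-rotate g (suc m) gn≡g0 = begin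
    sum (g ∘ suc) (upTo (suc m))       ≡⟨ sum-upTo-∷ʳ (g ∘ suc) m ⟩
    sum (g ∘ suc) (upTo m) ∙ g (suc m) ≡⟨ cong (sum (g ∘ suc) (upTo m) ∙_) gn≡g0 ⟩
    sum (g ∘ suc) (upTo m) ∙ g 0       ≡⟨ comm _ _ ⟩
    g 0 ∙ sum (g ∘ suc) (upTo m)       ≡⟨ sum-upTo-suc g m ⟨
    sum g (upTo (suc m))               ∎
    where open ≡-Reasoning

-- The cyclotomic ring ℤ[ζ_p]

if-≟-yes : {A : Set} {m n : ℕ} {a b : A} → m ≡ n → (if does (m ℕ.≟ n) then a else b) ≡ a
if-≟-yes {m = m} {n} {a} {b} m≡n = cong (if_then a else b) (dec-true (m ℕ.≟ n) m≡n)

if-≟-no : {A : Set} {m n : ℕ} {a b : A} → m ≢ n → (if does (m ℕ.≟ n) then a else b) ≡ b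
if-≟-no {m = m} {n} {a} {b} m≢n = cong (if_then a else b) (dec-false (m ℕ.≟ n) m≢n)

module Residues (p : ℕ) {{_ : NonZero p}} where
  open ≡-Reasoning
  open import Data.Nat using (_+_)
  open CommutativeSemigroupProperties ℕ.+-commutativeSemigroup
    using () renaming (x∙yz≈y∙xz to x+yz≡y+xz)

  %-absorbʳ : ∀ a b → (a + b % p) % p ≡ (a + b) % p
  %-absorbʳ a b = begin
    (a + b % p) % p           ≡⟨ %-distribˡ-+ a (b % p) p ⟩
    (a % p + b % p % p) % p   ≡⟨ cong (λ t → (a % p + t) % p) (m%n%n≡m%n b p) ⟩
    (a % p + b % p) % p       ≡⟨ %-distribˡ-+ a b p ⟨
    (a + b) % p               ∎

  %-absorbˡ : ∀ a b → (a % p + b) % p ≡ (a + b) % p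
  %-absorbˡ a b = begin
    (a % p + b) % p  ≡⟨ cong (_% p) (ℕ.+-comm (a % p) b) ⟩
    (b + a % p) % p  ≡⟨ %-absorbʳ b a ⟩
    (b + a) % p      ≡⟨ cong (_% p) (ℕ.+-comm b a) ⟩
    (a + b) % p      ∎

  %-cancelˡ : ∀ i {j j′} → (i + j) % p ≡ (i + j′) % p → j % p ≡ j′ % p
  %-cancelˡ i {j} {j′} eq = trans (shift j) (trans (cong (λ t → (c + t) % p) eq) (sym (shift j′)))
    where
    c = p ∸ i % p
    shift : ∀ j → j % p ≡ (c + (i + j) % p) % p
    shift j = begin
      j % p                      ≡⟨ [m+n]%n≡m%n j p ⟨
      (j + p) % p                ≡⟨ cong (λ t → (j + t) % p) (ℕ.m∸n+n≡m (ℕ.<⇒≤ (m%n<n i p))) ⟨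
      (j + (c + i % p)) % p      ≡⟨ cong (_% p) (ℕ.+-comm j (c + i % p)) ⟩
      (c + i % p + j) % p        ≡⟨ cong (_% p) (ℕ.+-assoc c (i % p) j) ⟩
      (c + (i % p + j)) % p      ≡⟨ %-absorbʳ c (i % p + j) ⟨
      (c + (i % p + j) % p) % p  ≡⟨ cong (λ t → (c + t) % p) (%-absorbˡ i j) ⟩
      (c + (i + j) % p) % p      ∎

  toℕ%p : (i : Fin p) → toℕ i % p ≡ toℕ i
  toℕ%p i = m<n⇒m%n≡m (Fin.toℕ<n i)

  residue : ℕ → Fin p
  residue a = fromℕ< (m%n<n a p)

  toℕ-residue : ∀ a → toℕ (residue a) ≡ a % p
  toℕ-residue a = Fin.toℕ-fromℕ< (m%n<n a p)

  infixl 6 _⊖_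
  _⊖_ : Fin p → Fin p → Fin p
  k ⊖ i = residue (toℕ k + (p ∸ toℕ i))

  +-⊖ : ∀ i k → (toℕ i + toℕ (k ⊖ i)) % p ≡ toℕ k
  +-⊖ i k = begin
    (toℕ i + toℕ (k ⊖ i)) % p             ≡⟨ cong (λ t → (toℕ i + t) % p) (toℕ-residue (toℕ k + (p ∸ toℕ i))) ⟩
    (toℕ i + (toℕ k + (p ∸ toℕ i)) % p) % p ≡⟨ %-absorbʳ (toℕ i) _ ⟩
    (toℕ i + (toℕ k + (p ∸ toℕ i))) % p   ≡⟨ cong (_% p) (x+yz≡y+xz (toℕ i) (toℕ k) _) ⟩
    (toℕ k + (toℕ i + (p ∸ toℕ i))) % p   ≡⟨ cong (λ t → (toℕ k + t) % p) (ℕ.m+[n∸m]≡n (ℕ.<⇒≤ (Fin.toℕ<n i))) ⟩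
    (toℕ k + p) % p                       ≡⟨ [m+n]%n≡m%n (toℕ k) p ⟩
    toℕ k % p                             ≡⟨ toℕ%p k ⟩
    toℕ k                                 ∎

  ⊖-unique : ∀ i j k → (toℕ i + toℕ j) % p ≡ toℕ k → j ≡ k ⊖ i
  ⊖-unique i j k eq = Fin.toℕ-injective (begin
    toℕ j               ≡⟨ toℕ%p j ⟨
    toℕ j % p           ≡⟨ %-cancelˡ (toℕ i) (trans eq (sym (+-⊖ i k))) ⟩
    toℕ (k ⊖ i) % p     ≡⟨ toℕ%p (k ⊖ i) ⟩
    toℕ (k ⊖ i)         ∎)

  ⊖-involutive : ∀ i k → k ⊖ (k ⊖ i) ≡ i
  ⊖-involutive i k = sym (⊖-unique (k ⊖ i) i k (trans (cong (_% p) (ℕ.+-comm (toℕ (k ⊖ i)) (toℕ i))) (+-⊖ i k)))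

-- Parameterised by Prime p rather than NonZero p, so that instance search finds NonZero p only
-- through the instance of Defs, as in the statement.
module Cyclotomic (p : ℕ) {{_ : Prime p}} where
  open Residues p
  module ∑ℤ = ListSum ℤ.+-0-isCommutativeMonoid
  open ∑ℤ using (sum)
  open import Data.Integer using (+_)
  open import Data.Nat using (_+_)
  open CommutativeSemigroupProperties ℤ.*-commutativeSemigroup
    using () renaming (x∙yz≈y∙xz to x*yz≡y*xz)

  *ᶜ-convolution : ∀ u v k → (u *ᶜ v) k ≡ sum (λ i → u i ℤ.* v (k ⊖ i)) (allFin p)
  *ᶜ-convolution u v k = trans (∑ℤ.foldr-map _ (allFin p)) (∑ℤ.sum-cong′ (allFin p) λ i →
    trans (∑ℤ.foldr-map _ (allFin p))
          (trans (∑ℤ.sum-single (Unique.allFin⁺ p) (∈-allFin (k ⊖ i)) (λ j _ j≢ → if-≟-no (j≢ ∘ ⊖-unique i j k)))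
                 (if-≟-yes (+-⊖ i k))))

  *ᶜ-comm : ∀ u v → u *ᶜ v ≗ v *ᶜ u
  *ᶜ-comm u v k = begin
    (u *ᶜ v) k                                            ≡⟨ *ᶜ-convolution u v k ⟩
    sum (λ i → u i ℤ.* v (k ⊖ i)) (allFin p)              ≡⟨ ∑ℤ.sum-cong′ (allFin p) swap ⟩
    sum (λ i → v (k ⊖ i) ℤ.* u (k ⊖ (k ⊖ i))) (allFin p)  ≡⟨ ∑ℤ.sum-bijection Fin._≟_ (Unique.allFin⁺ p) ∈-allFin (k ⊖_) (k ⊖_)
                                                               (λ i → ⊖-involutive i k) (λ i → ⊖-involutive i k) _ ⟩
    sum (λ i → v i ℤ.* u (k ⊖ i)) (allFin p)              ≡⟨ *ᶜ-convolution v u k ⟨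
    (v *ᶜ u) k                                            ∎
    where
    open ≡-Reasoning
    swap : ∀ i → u i ℤ.* v (k ⊖ i) ≡ v (k ⊖ i) ℤ.* u (k ⊖ (k ⊖ i))
    swap i = trans (ℤ.*-comm (u i) _) (cong (λ t → v (k ⊖ i) ℤ.* u t) (sym (⊖-involutive i k)))

  *ᶜ-cong : ∀ {u u′ v v′} → u ≗ u′ → v ≗ v′ → u *ᶜ v ≗ u′ *ᶜ v′
  *ᶜ-cong {u} {u′} {v} {v′} u≗u′ v≗v′ k = begin
    (u *ᶜ v) k                                 ≡⟨ *ᶜ-convolution u v k ⟩
    sum (λ i → u i ℤ.* v (k ⊖ i)) (allFin p)   ≡⟨ ∑ℤ.sum-cong′ (allFin p) (λ i → cong₂ ℤ._*_ (u≗u′ i) (v≗v′ (k ⊖ i))) ⟩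
    sum (λ i → u′ i ℤ.* v′ (k ⊖ i)) (allFin p) ≡⟨ *ᶜ-convolution u′ v′ k ⟨
    (u′ *ᶜ v′) k                               ∎
    where open ≡-Reasoning

  *ᶜ-congˡ≗ : ∀ u {v v′} → v ≗ v′ → u *ᶜ v ≗ u *ᶜ v′
  *ᶜ-congˡ≗ u = *ᶜ-cong {u} {u} (λ _ → refl)

  *ᶜ-distribˡ-+ᶜ : ∀ u v w → u *ᶜ (v +ᶜ w) ≗ (u *ᶜ v) +ᶜ (u *ᶜ w)
  *ᶜ-distribˡ-+ᶜ u v w k = begin
    (u *ᶜ (v +ᶜ w)) k                                                ≡⟨ *ᶜ-convolution u (v +ᶜ w) k ⟩
    sum (λ i → u i ℤ.* (v (k ⊖ i) ℤ.+ w (k ⊖ i))) (allFin p)         ≡⟨ ∑ℤ.sum-cong′ (allFin p) (λ i → ℤ.*-distribˡ-+ (u i) _ _) ⟩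
    sum (λ i → u i ℤ.* v (k ⊖ i) ℤ.+ u i ℤ.* w (k ⊖ i)) (allFin p)   ≡⟨ ∑ℤ.sum-∙ _ _ (allFin p) ⟩
    sum (λ i → u i ℤ.* v (k ⊖ i)) (allFin p) ℤ.+ sum (λ i → u i ℤ.* w (k ⊖ i)) (allFin p)
                                                                     ≡⟨ cong₂ ℤ._+_ (*ᶜ-convolution u v k) (*ᶜ-convolution u w k) ⟨
    ((u *ᶜ v) +ᶜ (u *ᶜ w)) k                                         ∎
    where open ≡-Reasoning

  *ᶜ-zeroʳ : ∀ u → u *ᶜ 0ᶜ ≗ 0ᶜ
  *ᶜ-zeroʳ u k = trans (*ᶜ-convolution u 0ᶜ k) (∑ℤ.sum-zero (allFin p) (λ i _ → ℤ.*-zeroʳ (u i)))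

  sum-*ˡ : {X : Set} (c : ℤ) (f : X → ℤ) (xs : List X) → sum (λ x → c ℤ.* f x) xs ≡ c ℤ.* sum f xs
  sum-*ˡ c f []       = sym (ℤ.*-zeroʳ c)
  sum-*ˡ c f (x ∷ xs) = trans (cong (λ t → c ℤ.* f x ℤ.+ t) (sum-*ˡ c f xs)) (sym (ℤ.*-distribˡ-+ c (f x) (sum f xs)))

  *ᶜ-·ᶜ : ∀ m u v → u *ᶜ (m ·ᶜ v) ≗ m ·ᶜ (u *ᶜ v)
  *ᶜ-·ᶜ m u v k = begin
    (u *ᶜ (m ·ᶜ v)) k                                    ≡⟨ *ᶜ-convolution u (m ·ᶜ v) k ⟩
    sum (λ i → u i ℤ.* (+ m ℤ.* v (k ⊖ i))) (allFin p)   ≡⟨ ∑ℤ.sum-cong′ (allFin p) (λ i → x*yz≡y*xz (u i) (+ m) _) ⟩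
    sum (λ i → + m ℤ.* (u i ℤ.* v (k ⊖ i))) (allFin p)   ≡⟨ sum-*ˡ (+ m) _ (allFin p) ⟩
    + m ℤ.* sum (λ i → u i ℤ.* v (k ⊖ i)) (allFin p)     ≡⟨ cong (+ m ℤ.*_) (*ᶜ-convolution u v k) ⟨
    (m ·ᶜ (u *ᶜ v)) k                                    ∎
    where open ≡-Reasoning

  sumᶜ-coordinate : {X : Set} (f : X → Cyc p) (xs : List X) (j : Fin p) → sumᶜ f xs j ≡ sum (λ x → f x j) xs
  sumᶜ-coordinate f []       j = refl
  sumᶜ-coordinate f (x ∷ xs) j = cong (λ t → f x j ℤ.+ t) (sumᶜ-coordinate f xs j)

  sumᶜ-cong : {X : Set} {f g : X → Cyc p} (xs : List X) → (∀ x → f x ≗ g x) → sumᶜ f xs ≗ sumᶜ g xs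
  sumᶜ-cong []       f≗g j = refl
  sumᶜ-cong (x ∷ xs) f≗g j = cong₂ ℤ._+_ (f≗g x j) (sumᶜ-cong xs f≗g j)

  sumᶜ-swap : {X Y : Set} (h : X → Y → Cyc p) (xs : List X) (ys : List Y) →
              sumᶜ (λ x → sumᶜ (h x) ys) xs ≗ sumᶜ (λ y → sumᶜ (λ x → h x y) xs) ys
  sumᶜ-swap h xs ys j = begin
    sumᶜ (λ x → sumᶜ (h x) ys) xs j           ≡⟨ sumᶜ-coordinate (λ x → sumᶜ (h x) ys) xs j ⟩
    sum (λ x → sumᶜ (h x) ys j) xs            ≡⟨ ∑ℤ.sum-cong′ xs (λ x → sumᶜ-coordinate (h x) ys j) ⟩
    sum (λ x → sum (λ y → h x y j) ys) xs     ≡⟨ ∑ℤ.sum-swap (λ x y → h x y j) xs ys ⟩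
    sum (λ y → sum (λ x → h x y j) xs) ys     ≡⟨ ∑ℤ.sum-cong′ ys (λ y → sumᶜ-coordinate (λ x → h x y) xs j) ⟨
    sum (λ y → sumᶜ (λ x → h x y) xs j) ys    ≡⟨ sumᶜ-coordinate (λ y → sumᶜ (λ x → h x y) xs) ys j ⟨
    sumᶜ (λ y → sumᶜ (λ x → h x y) xs) ys j   ∎
    where open ≡-Reasoning

  sumᶜ-bijection : {X : Set} → DecidableEquality X → {xs : List X} → Unique xs → (∀ x → x ∈ xs) →
                   (σ τ : X → X) → (∀ x → τ (σ x) ≡ x) → (∀ y → σ (τ y) ≡ y) →
                   (g : X → Cyc p) → sumᶜ (g ∘ σ) xs ≗ sumᶜ g xs
  sumᶜ-bijection _≟_ {xs} u all σ τ τσ στ g j =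
    trans (sumᶜ-coordinate (g ∘ σ) xs j)
          (trans (∑ℤ.sum-bijection _≟_ u all σ τ τσ στ (λ x → g x j)) (sym (sumᶜ-coordinate g xs j)))

  *ᶜ-sumᶜʳ : {X : Set} (u : Cyc p) (f : X → Cyc p) (xs : List X) → u *ᶜ sumᶜ f xs ≗ sumᶜ (λ x → u *ᶜ f x) xs
  *ᶜ-sumᶜʳ u f []       = *ᶜ-zeroʳ u
  *ᶜ-sumᶜʳ u f (x ∷ xs) j = trans (*ᶜ-distribˡ-+ᶜ u (f x) (sumᶜ f xs) j) (cong (λ t → (u *ᶜ f x) j ℤ.+ t) (*ᶜ-sumᶜʳ u f xs j))

  *ᶜ-sumᶜˡ : {X : Set} (u : Cyc p) (f : X → Cyc p) (xs : List X) → sumᶜ f xs *ᶜ u ≗ sumᶜ (λ x → f x *ᶜ u) xs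
  *ᶜ-sumᶜˡ u f xs j = trans (*ᶜ-comm (sumᶜ f xs) u j)
                      (trans (*ᶜ-sumᶜʳ u f xs j) (sumᶜ-cong xs (λ x → *ᶜ-comm u (f x)) j))

  ·ᶜ-sumᶜ : {X : Set} (m : ℕ) (f : X → Cyc p) (xs : List X) → m ·ᶜ sumᶜ f xs ≗ sumᶜ (λ x → m ·ᶜ f x) xs
  ·ᶜ-sumᶜ m f []       j = ℤ.*-zeroʳ (+ m)
  ·ᶜ-sumᶜ m f (x ∷ xs) j = trans (ℤ.*-distribˡ-+ (+ m) (f x j) _) (cong (λ t → (m ·ᶜ f x) j ℤ.+ t) (·ᶜ-sumᶜ m f xs j))

  sumᶜ-const : {X : Set} (u : Cyc p) (xs : List X) → sumᶜ (λ _ → u) xs ≗ length xs ·ᶜ u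
  sumᶜ-const u []       j = sym (ℤ.*-zeroˡ (u j))
  sumᶜ-const u (x ∷ xs) j = begin
    u j ℤ.+ sumᶜ (λ _ → u) xs j          ≡⟨ cong (λ t → u j ℤ.+ t) (sumᶜ-const u xs j) ⟩
    u j ℤ.+ + length xs ℤ.* u j          ≡⟨ cong (ℤ._+ (+ length xs ℤ.* u j)) (ℤ.*-identityˡ (u j)) ⟨
    + 1 ℤ.* u j ℤ.+ + length xs ℤ.* u j  ≡⟨ ℤ.*-distribʳ-+ (u j) (+ 1) (+ length xs) ⟨
    + suc (length xs) ℤ.* u j            ∎
    where open ≡-Reasoning

  -- _≈ᶜ_ as a record, so that both sides can be inferred from a proof.
  infix 4 _≈_
  record _≈_ (u v : Cyc p) : Set where
    constructor mk≈
    field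
      offset    : ℤ
      pointwise : ∀ j → u j ℤ.- v j ≡ offset

  ≈⇒≈ᶜ : ∀ {u v} → u ≈ v → u ≈ᶜ v
  ≈⇒≈ᶜ (mk≈ c eq) = c , eq

  open ℤ-Solver.+-*-Solver

  ≗⇒≈ : ∀ {u v} → u ≗ v → u ≈ v
  ≗⇒≈ {u} {v} u≗v = mk≈ (+ 0) λ j → trans (cong (ℤ._- v j) (u≗v j)) (ℤ.+-inverseʳ (v j))

  ≈-isEquivalence : IsEquivalence _≈_
  ≈-isEquivalence = record
    { refl  = ≗⇒≈ (λ _ → refl)
    ; sym   = λ { {u} {v} (mk≈ c eq) → mk≈ (ℤ.- c) λ j →
                    trans (solve 2 (λ a b → b :- a := :- (a :- b)) refl (u j) (v j)) (cong ℤ.-_ (eq j)) }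
    ; trans = λ { {u} {v} {w} (mk≈ c eq) (mk≈ d eq′) → mk≈ (c ℤ.+ d) λ j →
                    trans (solve 3 (λ a b c → a :- c := (a :- b) :+ (b :- c)) refl (u j) (v j) (w j))
                          (cong₂ ℤ._+_ (eq j) (eq′ j)) }
    }

  module ≗-Reasoning = SetoidReasoning (Fin p →-setoid ℤ)

  ≈-setoid : Setoid 0ℓ 0ℓ
  ≈-setoid = record { isEquivalence = ≈-isEquivalence }

  module ≈-Reasoning = SetoidReasoning ≈-setoid

  open IsEquivalence ≈-isEquivalence public using () renaming (refl to ≈-refl; sym to ≈-sym; trans to ≈-trans)

  +ᶜ-cong : ∀ {u u′ v v′} → u ≈ u′ → v ≈ v′ → u +ᶜ v ≈ u′ +ᶜ v′
  +ᶜ-cong {u} {u′} {v} {v′} (mk≈ c eq) (mk≈ d eq′) = mk≈ (c ℤ.+ d) λ j →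
    trans (solve 4 (λ a a′ b b′ → (a :+ b) :- (a′ :+ b′) := (a :- a′) :+ (b :- b′)) refl (u j) (u′ j) (v j) (v′ j))
          (cong₂ ℤ._+_ (eq j) (eq′ j))

  ·ᶜ-cong : ∀ m {u v} → u ≈ v → m ·ᶜ u ≈ m ·ᶜ v
  ·ᶜ-cong m {u} {v} (mk≈ c eq) = mk≈ (+ m ℤ.* c) λ j →
    trans (solve 3 (λ a b m → m :* a :- m :* b := m :* (a :- b)) refl (u j) (v j) (+ m)) (cong (+ m ℤ.*_) (eq j))

  *ᶜ-congˡ : ∀ u {v w} → v ≈ w → u *ᶜ v ≈ u *ᶜ w
  *ᶜ-congˡ u {v} {w} (mk≈ c eq) = mk≈ (sum (λ i → u i ℤ.* c) (allFin p)) λ k → begin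
    (u *ᶜ v) k ℤ.- (u *ᶜ w) k                                           ≡⟨ cong₂ ℤ._-_ (*ᶜ-convolution u v k) (*ᶜ-convolution u w k) ⟩
    sum (λ i → u i ℤ.* v (k ⊖ i)) (allFin p) ℤ.- sum (λ i → u i ℤ.* w (k ⊖ i)) (allFin p)
                                                                        ≡⟨ sum-- _ _ (allFin p) ⟩
    sum (λ i → u i ℤ.* v (k ⊖ i) ℤ.- u i ℤ.* w (k ⊖ i)) (allFin p)      ≡⟨ ∑ℤ.sum-cong′ (allFin p) (λ i →
                                                                             trans (solve 3 (λ a b c → a :* b :- a :* c := a :* (b :- c)) refl (u i) _ _)
                                                                                   (cong (u i ℤ.*_) (eq (k ⊖ i)))) ⟩
    sum (λ i → u i ℤ.* c) (allFin p)                                    ∎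
    where
    open ≡-Reasoning
    sum-- : {X : Set} (f g : X → ℤ) (xs : List X) → sum f xs ℤ.- sum g xs ≡ sum (λ x → f x ℤ.- g x) xs
    sum-- f g []       = refl
    sum-- f g (x ∷ xs) = trans (solve 4 (λ a b c d → (a :+ b) :- (c :+ d) := (a :- c) :+ (b :- d)) refl (f x) (sum f xs) (g x) (sum g xs))
                               (cong (λ t → f x ℤ.- g x ℤ.+ t) (sum-- f g xs))

  *ᶜ-congʳ : ∀ {u v} w → u ≈ v → u *ᶜ w ≈ v *ᶜ w
  *ᶜ-congʳ {u} {v} w u≈v = ≈-trans (≗⇒≈ (*ᶜ-comm u w)) (≈-trans (*ᶜ-congˡ w u≈v) (≗⇒≈ (*ᶜ-comm w v)))

  sumᶜ-cong≈ : {X : Set} {f g : X → Cyc p} (xs : List X) → (∀ x → x ∈ xs → f x ≈ g x) → sumᶜ f xs ≈ sumᶜ g xs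
  sumᶜ-cong≈ []       f≈g = ≈-refl
  sumᶜ-cong≈ (x ∷ xs) f≈g = +ᶜ-cong (f≈g x (here refl)) (sumᶜ-cong≈ xs (λ y → f≈g y ∘ there))

  +ᶜ-identityˡ : (u : Cyc p) → 0ᶜ +ᶜ u ≗ u
  +ᶜ-identityˡ u j = ℤ.+-identityˡ (u j)

  sumᶜ-zero : {X : Set} {f : X → Cyc p} (xs : List X) → (∀ x → x ∈ xs → f x ≈ 0ᶜ) → sumᶜ f xs ≈ 0ᶜ
  sumᶜ-zero []       f≈0 = ≈-refl
  sumᶜ-zero (x ∷ xs) f≈0 = ≈-trans (+ᶜ-cong (f≈0 x (here refl)) (sumᶜ-zero xs (λ y → f≈0 y ∘ there))) (≗⇒≈ (+ᶜ-identityˡ 0ᶜ))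

  sumᶜ-single : {X : Set} {f : X → Cyc p} {x₀ : X} {xs : List X} → Unique xs → x₀ ∈ xs →
                (∀ x → x ∈ xs → x ≢ x₀ → f x ≈ 0ᶜ) → sumᶜ f xs ≈ f x₀
  sumᶜ-single {f = f} {xs = x ∷ xs} (x∉xs ∷ _) (here refl) f≈0 = begin
    f x +ᶜ sumᶜ f xs ≈⟨ +ᶜ-cong (≈-refl {f x}) (sumᶜ-zero xs (λ y y∈ → f≈0 y (there y∈) (λ { refl → All¬⇒¬Any x∉xs y∈ }))) ⟩
    f x +ᶜ 0ᶜ        ≈⟨ ≗⇒≈ (λ j → ℤ.+-identityʳ (f x j)) ⟩
    f x              ∎
    where open ≈-Reasoning
  sumᶜ-single {f = f} {x₀} {x ∷ xs} (x∉xs ∷ u) (there x₀∈) f≈0 = begin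
    f x +ᶜ sumᶜ f xs ≈⟨ +ᶜ-cong (f≈0 x (here refl) (λ { refl → All¬⇒¬Any x∉xs x₀∈ })) (sumᶜ-single u x₀∈ (λ y → f≈0 y ∘ there)) ⟩
    0ᶜ +ᶜ f x₀       ≈⟨ ≗⇒≈ (+ᶜ-identityˡ (f x₀)) ⟩
    f x₀             ∎
    where open ≈-Reasoning

  sumᶜ-filter : {X : Set} {P : X → Set} (P? : (x : X) → Dec (P x)) (f : X → Cyc p) (xs : List X) →
                (∀ x → ¬ P x → f x ≈ 0ᶜ) → sumᶜ f (filter P? xs) ≈ sumᶜ f xs
  sumᶜ-filter P? f []       f≈0 = ≈-refl
  sumᶜ-filter P? f (x ∷ xs) f≈0 with P? x
  ... | yes _  = +ᶜ-cong (≈-refl {f x}) (sumᶜ-filter P? f xs f≈0)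
  ... | no ¬Px = ≈-trans (≗⇒≈ (λ j → sym (+ᶜ-identityˡ (sumᶜ f (filter P? xs)) j)))
                         (+ᶜ-cong (≈-sym (f≈0 x ¬Px)) (sumᶜ-filter P? f xs f≈0))

  u≈0⇒u*v≈0 : ∀ {u} (v : Cyc p) → u ≈ 0ᶜ → u *ᶜ v ≈ 0ᶜ
  u≈0⇒u*v≈0 v u≈0 = ≈-trans (*ᶜ-congʳ v u≈0) (≗⇒≈ (λ k → trans (*ᶜ-comm 0ᶜ v k) (*ᶜ-zeroʳ v k)))

  v≈0⇒u*v≈0 : ∀ (u : Cyc p) {v} → v ≈ 0ᶜ → u *ᶜ v ≈ 0ᶜ
  v≈0⇒u*v≈0 u v≈0 = ≈-trans (*ᶜ-congˡ u v≈0) (≗⇒≈ (*ᶜ-zeroʳ u))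

  ε-cong : ∀ {a b} → a % p ≡ b % p → ε {p} a ≗ ε b
  ε-cong eq j = cong (λ t → if does (toℕ j ℕ.≟ t) then + 1 else + 0) eq

  ε-convolution : ∀ a (v : Cyc p) k → (ε a *ᶜ v) k ≡ v (k ⊖ residue a)
  ε-convolution a v k = begin
    (ε a *ᶜ v) k                                 ≡⟨ *ᶜ-convolution (ε a) v k ⟩
    sum (λ i → ε a i ℤ.* v (k ⊖ i)) (allFin p)   ≡⟨ ∑ℤ.sum-single (Unique.allFin⁺ p) (∈-allFin (residue a)) off ⟩
    ε a (residue a) ℤ.* v (k ⊖ residue a)        ≡⟨ cong (ℤ._* v (k ⊖ residue a)) (if-≟-yes (toℕ-residue a)) ⟩
    + 1 ℤ.* v (k ⊖ residue a)                    ≡⟨ ℤ.*-identityˡ _ ⟩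
    v (k ⊖ residue a)                            ∎
    where
    open ≡-Reasoning
    off : ∀ i → i ∈ allFin p → i ≢ residue a → ε a i ℤ.* v (k ⊖ i) ≡ + 0
    off i _ i≢ = trans (cong (ℤ._* v (k ⊖ i)) (if-≟-no (λ eq → i≢ (Fin.toℕ-injective (trans eq (sym (toℕ-residue a)))))))
                       (ℤ.*-zeroˡ (v (k ⊖ i)))

  ε-+ : ∀ a b → ε {p} a *ᶜ ε b ≗ ε (a + b)
  ε-+ a b k with toℕ k ℕ.≟ (a + b) % p
  ... | yes k≡ = trans (ε-convolution a (ε b) k) (trans (if-≟-yes (begin
    toℕ (k ⊖ residue a)   ≡⟨ cong toℕ (⊖-unique (residue a) (residue b) k (trans sum≡ (sym k≡))) ⟨
    toℕ (residue b)       ≡⟨ toℕ-residue b ⟩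
    b % p                 ∎)) (sym (if-≟-yes k≡)))
    where
    open ≡-Reasoning
    sum≡ : (toℕ (residue a) + toℕ (residue b)) % p ≡ (a + b) % p
    sum≡ = trans (cong₂ (λ s t → (s + t) % p) (toℕ-residue a) (toℕ-residue b)) (sym (%-distribˡ-+ a b p))
  ... | no k≢  = trans (ε-convolution a (ε b) k) (trans (if-≟-no (λ eq → k≢ (begin
    toℕ k                                        ≡⟨ +-⊖ (residue a) k ⟨
    (toℕ (residue a) + toℕ (k ⊖ residue a)) % p  ≡⟨ cong₂ (λ s t → (s + t) % p) (toℕ-residue a) eq ⟩
    (a % p + b % p) % p                          ≡⟨ %-distribˡ-+ a b p ⟨
    (a + b) % p                                  ∎))) (sym (if-≟-no k≢)))
    where open ≡-Reasoning

  -- Multiplication by ζ rotates the coefficients, so an invariant vector is constant, i.e. zero in ℂ.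
  ζ-invariant⇒≈0 : (v : Cyc p) → v ≗ ε 1 *ᶜ v → v ≈ 0ᶜ
  ζ-invariant⇒≈0 v v≗ζv = mk≈ (v (fromℕ< 0<p)) λ j → begin
    v j ℤ.- + 0               ≡⟨ ℤ.+-identityʳ (v j) ⟩
    v j                       ≡⟨ cong v (Fin.fromℕ<-toℕ j (Fin.toℕ<n j)) ⟨
    v (fromℕ< (Fin.toℕ<n j))  ≡⟨ constant (toℕ j) (Fin.toℕ<n j) ⟩
    v (fromℕ< 0<p)            ∎
    where
    open ≡-Reasoning
    0<p : 0 ℕ.< p
    0<p = ℕ.>-nonZero⁻¹ p
    predecessor : ∀ m (m+1<p : suc m ℕ.< p) → fromℕ< (ℕ.<-trans (ℕ.n<1+n m) m+1<p) ≡ fromℕ< m+1<p ⊖ residue 1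
    predecessor m m+1<p = ⊖-unique (residue 1) _ (fromℕ< m+1<p) (begin
      (toℕ (residue 1) + toℕ (fromℕ< _)) % p ≡⟨ cong₂ (λ s t → (s + t) % p) (toℕ-residue 1) (Fin.toℕ-fromℕ< _) ⟩
      (1 % p + m) % p                         ≡⟨ %-absorbˡ 1 m ⟩
      suc m % p                               ≡⟨ m<n⇒m%n≡m m+1<p ⟩
      suc m                                   ≡⟨ Fin.toℕ-fromℕ< m+1<p ⟨
      toℕ (fromℕ< m+1<p)                      ∎)
    constant : ∀ m (m<p : m ℕ.< p) → v (fromℕ< m<p) ≡ v (fromℕ< 0<p)
    constant zero    m<p   = refl
    constant (suc m) m+1<p = begin
      v (fromℕ< m+1<p)                         ≡⟨ v≗ζv (fromℕ< m+1<p) ⟩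
      (ε 1 *ᶜ v) (fromℕ< m+1<p)                ≡⟨ ε-convolution 1 v (fromℕ< m+1<p) ⟩
      v (fromℕ< m+1<p ⊖ residue 1)             ≡⟨ cong v (predecessor m m+1<p) ⟨
      v (fromℕ< (ℕ.<-trans (ℕ.n<1+n m) m+1<p)) ≡⟨ constant m (ℕ.<-trans (ℕ.n<1+n m) m+1<p) ⟩
      v (fromℕ< 0<p)                           ∎

-- Finite fields

module FieldProperties (F : FiniteField) where
  open FiniteField F public hiding (Carrier)

  K : Set
  K = Carrier F

  commutativeRing : CommutativeRing 0ℓ 0ℓ
  commutativeRing = record { isCommutativeRing = isCommutativeRing }

  open CommutativeRing commutativeRing public
    using ( +-assoc; +-comm; +-identityˡ; +-identityʳ; -‿inverseˡ; -‿inverseʳ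
          ; *-assoc; *-comm; *-identityˡ; *-identityʳ; zeroˡ; zeroʳ; distribʳ
          ; +-isCommutativeMonoid; *-isCommutativeMonoid; semiring; commutativeSemiring; ring )
  open RingProperties ring public using (-0#≈0#; -‿involutive; -‿+-comm; -‿distribˡ-*; -‿distribʳ-*)
  module ∑F = ListSum +-isCommutativeMonoid
  module ∏F = ListSum *-isCommutativeMonoid

  open ≡-Reasoning
  open CommutativeSemigroupProperties (CommutativeRing.+-commutativeSemigroup commutativeRing)
    using () renaming (interchange to +-interchange; x∙yz≈y∙xz to +-x∙yz≈y∙xz)

  private
    module Mult = SemiringMult semiring
    module Exp  = SemiringExp semiring
    module Sum  = MonoidSum (CommutativeRing.+-monoid commutativeRing)
    module Bin  = Binomial commutativeSemiring

  ×1≡×1# : ∀ m → m ×1 ≡ m Mult.× 1#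
  ×1≡×1# zero    = refl
  ×1≡×1# (suc m) = cong (1# +_) (×1≡×1# m)

  ^≡^ : ∀ x n → x ^ n ≡ x Exp.^ n
  ^≡^ x zero    = refl
  ^≡^ x (suc n) = cong (x *_) (^≡^ x n)

  ×1-homo-+ : ∀ m n → (m ℕ.+ n) ×1 ≡ m ×1 + n ×1
  ×1-homo-+ m n = begin
    (m ℕ.+ n) ×1                ≡⟨ ×1≡×1# (m ℕ.+ n) ⟩
    (m ℕ.+ n) Mult.× 1#         ≡⟨ Mult.×-homo-+ 1# m n ⟩
    m Mult.× 1# + n Mult.× 1#   ≡⟨ cong₂ _+_ (×1≡×1# m) (×1≡×1# n) ⟨
    m ×1 + n ×1                 ∎

  ×1-homo-* : ∀ m n → (m ℕ.* n) ×1 ≡ m ×1 * n ×1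
  ×1-homo-* m n = begin
    (m ℕ.* n) ×1                ≡⟨ ×1≡×1# (m ℕ.* n) ⟩
    (m ℕ.* n) Mult.× 1#         ≡⟨ Mult.×1-homo-* m n ⟩
    m Mult.× 1# * n Mult.× 1#   ≡⟨ cong₂ _*_ (×1≡×1# m) (×1≡×1# n) ⟨
    m ×1 * n ×1                 ∎

  ^-homo-* : ∀ x m n → x ^ (m ℕ.+ n) ≡ x ^ m * x ^ n
  ^-homo-* x m n = begin
    x ^ (m ℕ.+ n)             ≡⟨ ^≡^ x (m ℕ.+ n) ⟩
    x Exp.^ (m ℕ.+ n)         ≡⟨ Exp.^-homo-* x m n ⟩
    x Exp.^ m * x Exp.^ n     ≡⟨ cong₂ _*_ (^≡^ x m) (^≡^ x n) ⟨
    x ^ m * x ^ n             ∎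

  ^-assocʳ : ∀ x m n → (x ^ m) ^ n ≡ x ^ (m ℕ.* n)
  ^-assocʳ x m n = begin
    (x ^ m) ^ n               ≡⟨ trans (^≡^ (x ^ m) n) (cong (Exp._^ n) (^≡^ x m)) ⟩
    (x Exp.^ m) Exp.^ n       ≡⟨ Exp.^-assocʳ x m n ⟩
    x Exp.^ (m ℕ.* n)         ≡⟨ ^≡^ x (m ℕ.* n) ⟨
    x ^ (m ℕ.* n)             ∎

  ℤ→K : ℤ → K
  ℤ→K (ℤ.+ n)      = n ×1
  ℤ→K -[1+ n ]   = - (suc n ×1)

  ℤ→K-homo-neg : ∀ i → ℤ→K (ℤ.- i) ≡ - ℤ→K i
  ℤ→K-homo-neg (ℤ.+ zero)  = sym -0#≈0#
  ℤ→K-homo-neg +[1+ n ]  = refl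
  ℤ→K-homo-neg -[1+ n ]  = sym (-‿involutive _)

  ℤ→K-homo-⊖ : ∀ m n → ℤ→K (m ℤ.⊖ n) ≡ (m ×1) - (n ×1)
  ℤ→K-homo-⊖ zero    zero    = sym (-‿inverseʳ 0#)
  ℤ→K-homo-⊖ zero    (suc n) = sym (+-identityˡ _)
  ℤ→K-homo-⊖ (suc m) zero    = sym (trans (cong (suc m ×1 +_) -0#≈0#) (+-identityʳ _))
  ℤ→K-homo-⊖ (suc m) (suc n) = begin
    ℤ→K (suc m ℤ.⊖ suc n)                 ≡⟨ cong ℤ→K (ℤ.[1+m]⊖[1+n]≡m⊖n m n) ⟩
    ℤ→K (m ℤ.⊖ n)                         ≡⟨ ℤ→K-homo-⊖ m n ⟩
    (m ×1) - (n ×1)                           ≡⟨ +-identityˡ _ ⟨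
    0# + ((m ×1) - (n ×1))                    ≡⟨ cong (_+ ((m ×1) - (n ×1))) (-‿inverseʳ 1#) ⟨
    (1# - 1#) + ((m ×1) - (n ×1))             ≡⟨ +-interchange 1# (- 1#) (m ×1) (- (n ×1)) ⟩
    (1# + m ×1) + (- 1# + - (n ×1))       ≡⟨ cong ((1# + m ×1) +_) (-‿+-comm 1# (n ×1)) ⟩
    (1# + m ×1) - (1# + n ×1)             ∎

  ℤ→K-homo-+ : ∀ i j → ℤ→K (i ℤ.+ j) ≡ ℤ→K i + ℤ→K j
  ℤ→K-homo-+ (ℤ.+ m)    (ℤ.+ n)    = ×1-homo-+ m n
  ℤ→K-homo-+ (ℤ.+ m)    -[1+ n ] = ℤ→K-homo-⊖ m (suc n)
  ℤ→K-homo-+ -[1+ m ] (ℤ.+ n)    = trans (ℤ→K-homo-⊖ n (suc m)) (+-comm _ _)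
  ℤ→K-homo-+ -[1+ m ] -[1+ n ] = begin
    - (1# + suc (m ℕ.+ n) ×1)       ≡⟨ cong (λ t → - (1# + t)) (×1-homo-+ (suc m) n) ⟩
    - (1# + (suc m ×1 + n ×1))      ≡⟨ cong -_ (+-x∙yz≈y∙xz 1# (suc m ×1) (n ×1)) ⟩
    - (suc m ×1 + suc n ×1)         ≡⟨ -‿+-comm _ _ ⟨
    - (suc m ×1) + - (suc n ×1)     ∎

  ℤ→K-homo-+* : ∀ m j → ℤ→K (ℤ.+ m ℤ.* j) ≡ m ×1 * ℤ→K j
  ℤ→K-homo-+* m (ℤ.+ n)    = trans (cong ℤ→K (sym (ℤ.pos-* m n))) (×1-homo-* m n)
  ℤ→K-homo-+* m -[1+ n ] = begin
    ℤ→K (ℤ.+ m ℤ.* -[1+ n ])          ≡⟨ cong ℤ→K (ℤ.neg-distribʳ-* (ℤ.+ m) (ℤ.+ suc n)) ⟨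
    ℤ→K (ℤ.- (ℤ.+ m ℤ.* ℤ.+ suc n))     ≡⟨ ℤ→K-homo-neg (ℤ.+ m ℤ.* ℤ.+ suc n) ⟩
    - ℤ→K (ℤ.+ m ℤ.* ℤ.+ suc n)         ≡⟨ cong -_ (ℤ→K-homo-+* m (ℤ.+ suc n)) ⟩
    - (m ×1 * suc n ×1)             ≡⟨ -‿distribʳ-* _ _ ⟩
    m ×1 * - (suc n ×1)             ∎

  ℤ→K-homo-* : ∀ i j → ℤ→K (i ℤ.* j) ≡ ℤ→K i * ℤ→K j
  ℤ→K-homo-* (ℤ.+ m)    j = ℤ→K-homo-+* m j
  ℤ→K-homo-* -[1+ m ] j = begin
    ℤ→K (-[1+ m ] ℤ.* j)            ≡⟨ cong ℤ→K (ℤ.neg-distribˡ-* (ℤ.+ suc m) j) ⟨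
    ℤ→K (ℤ.- (ℤ.+ suc m ℤ.* j))       ≡⟨ ℤ→K-homo-neg (ℤ.+ suc m ℤ.* j) ⟩
    - ℤ→K (ℤ.+ suc m ℤ.* j)           ≡⟨ cong -_ (ℤ→K-homo-+* (suc m) j) ⟩
    - (suc m ×1 * ℤ→K j)            ≡⟨ -‿distribˡ-* _ _ ⟩
    - (suc m ×1) * ℤ→K j            ∎

  ℤ→K-morphism : ℤ.+-*-rawRing ACR.-Raw-AlmostCommutative⟶ ACR.fromCommutativeRing commutativeRing
  ℤ→K-morphism = record
    { ⟦_⟧    = ℤ→K
    ; +-homo = ℤ→K-homo-+
    ; *-homo = ℤ→K-homo-*
    ; -‿homo = ℤ→K-homo-neg
    ; 0-homo = refl
    ; 1-homo = +-identityʳ 1#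
    }

  ℤ→K-≟ : ∀ i j → Maybe.Maybe (ℤ→K i ≡ ℤ→K j)
  ℤ→K-≟ i j = Maybe.map (cong ℤ→K) (dec⇒maybe (i ℤ.≟ j))

  -- The ring solver needs coefficients with a computable equality, hence integer coefficients.
  open RingSolver ℤ.+-*-rawRing (ACR.fromCommutativeRing commutativeRing) ℤ→K-morphism ℤ→K-≟
    public using (solve; _:=_; _:+_; _:*_; :-_; _:-_; con)

  0^suc : ∀ n → 0# ^ suc n ≡ 0#
  0^suc n = zeroˡ _

  1^ : ∀ n → 1# ^ n ≡ 1#
  1^ zero    = refl
  1^ (suc n) = trans (*-identityˡ _) (1^ n)

  x-y≡0⇒x≡y : ∀ {x y} → x - y ≡ 0# → x ≡ y
  x-y≡0⇒x≡y {x} {y} x-y≡0 = begin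
    x            ≡⟨ solve 2 (λ x y → x := (x :- y) :+ y) refl x y ⟩
    (x - y) + y  ≡⟨ cong (_+ y) x-y≡0 ⟩
    0# + y       ≡⟨ +-identityˡ y ⟩
    y            ∎

  x+y≡x⇒y≡0 : ∀ {x y} → x + y ≡ x → y ≡ 0#
  x+y≡x⇒y≡0 {x} {y} x+y≡x = begin
    y            ≡⟨ solve 2 (λ x y → y := (x :+ y) :- x) refl x y ⟩
    (x + y) - x  ≡⟨ cong (_- x) x+y≡x ⟩
    x - x        ≡⟨ -‿inverseʳ x ⟩
    0#           ∎

  inv : (x : K) → x ≢ 0# → K
  inv x x≢0 = proj₁ (inverse x x≢0)

  *-inverseʳ : ∀ x (x≢0 : x ≢ 0#) → x * inv x x≢0 ≡ 1#
  *-inverseʳ x x≢0 = proj₂ (inverse x x≢0)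

  *-inverseˡ : ∀ x (x≢0 : x ≢ 0#) → inv x x≢0 * x ≡ 1#
  *-inverseˡ x x≢0 = trans (*-comm _ x) (*-inverseʳ x x≢0)

  *-integral : ∀ {x y} → x * y ≡ 0# → x ≡ 0# ⊎ y ≡ 0#
  *-integral {x} {y} xy≡0 with x ≟ 0#
  ... | yes x≡0 = inj₁ x≡0
  ... | no  x≢0 = inj₂ (begin
    y                     ≡⟨ *-identityˡ y ⟨
    1# * y                ≡⟨ cong (_* y) (*-inverseˡ x x≢0) ⟨
    (inv x x≢0 * x) * y   ≡⟨ *-assoc _ x y ⟩
    inv x x≢0 * (x * y)   ≡⟨ cong (inv x x≢0 *_) xy≡0 ⟩
    inv x x≢0 * 0#        ≡⟨ zeroʳ _ ⟩
    0#                    ∎)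

  *-nonzero : ∀ {x y} → x ≢ 0# → y ≢ 0# → x * y ≢ 0#
  *-nonzero x≢0 y≢0 xy≡0 with *-integral xy≡0
  ... | inj₁ x≡0 = x≢0 x≡0
  ... | inj₂ y≡0 = y≢0 y≡0

  *-cancelˡ : ∀ {x y z} → x ≢ 0# → x * y ≡ x * z → y ≡ z
  *-cancelˡ {x} {y} {z} x≢0 xy≡xz with *-integral {x} {y - z} (begin
    x * (y - z)          ≡⟨ solve 3 (λ x y z → x :* (y :- z) := x :* y :- x :* z) refl x y z ⟩
    (x * y) - (x * z)    ≡⟨ cong (_- (x * z)) xy≡xz ⟩
    (x * z) - (x * z)    ≡⟨ -‿inverseʳ (x * z) ⟩
    0#                   ∎)
  ... | inj₁ x≡0   = ⊥-elim (x≢0 x≡0)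
  ... | inj₂ y-z≡0 = x-y≡0⇒x≡y y-z≡0

  ×1≡0⇒×≡0 : ∀ n z → n ×1 ≡ 0# → n Mult.× z ≡ 0#
  ×1≡0⇒×≡0 n z n≡0 = begin
    n Mult.× z            ≡⟨ cong (n Mult.×_) (*-identityˡ z) ⟨
    n Mult.× (1# * z)     ≡⟨ Mult.×-assoc-* n 1# z ⟨
    (n Mult.× 1#) * z     ≡⟨ cong (_* z) (trans (sym (×1≡×1# n)) n≡0) ⟩
    0# * z                ≡⟨ zeroˡ z ⟩
    0#                    ∎

  ^-additive : ∀ m → (∀ k → 0 ℕ.< k → k ℕ.≤ m → (suc m C k) ×1 ≡ 0#) →
               ∀ x y → (x + y) ^ suc m ≡ x ^ suc m + y ^ suc m
  ^-additive m vanish x y = begin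
    (x + y) ^ suc m                                 ≡⟨ ^≡^ (x + y) (suc m) ⟩
    (x + y) Exp.^ suc m                             ≡⟨ Bin.theorem (suc m) x y ⟩
    t Fin.zero + Sum.sum (t ∘ Fin.suc)              ≡⟨ cong (t Fin.zero +_) (Sum.sum-init-last (t ∘ Fin.suc)) ⟩
    t Fin.zero + (Sum.sum (t ∘ Fin.suc ∘ Fin.inject₁) + t (Fin.suc (fromℕ m)))
                                                    ≡⟨ cong (λ s → t Fin.zero + (s + t (Fin.suc (fromℕ m)))) inner≡0 ⟩
    t Fin.zero + (0# + t (Fin.suc (fromℕ m)))       ≡⟨ cong₂ _+_ first (trans (+-identityˡ _) last) ⟩
    y ^ suc m + x ^ suc m                           ≡⟨ +-comm _ _ ⟩
    x ^ suc m + y ^ suc m                           ∎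
    where
    t = Bin.binomialTerm x y (suc m)
    first : t Fin.zero ≡ y ^ suc m
    first = begin
      (1# * y Exp.^ suc m) + 0#    ≡⟨ +-identityʳ _ ⟩
      1# * y Exp.^ suc m           ≡⟨ *-identityˡ _ ⟩
      y Exp.^ suc m                ≡⟨ ^≡^ y (suc m) ⟨
      y ^ suc m                    ∎
    inner≡0 : Sum.sum (t ∘ Fin.suc ∘ Fin.inject₁) ≡ 0#
    inner≡0 = trans (Sum.sum-cong-≗ {m} {t ∘ Fin.suc ∘ Fin.inject₁} {replicate m 0#} inner-term≡0)
                    (Sum.sum-replicate-zero m)
      where
      inner-term≡0 : ∀ i → t (Fin.suc (Fin.inject₁ i)) ≡ 0#
      inner-term≡0 i = ×1≡0⇒×≡0 (suc m C suc k) (Bin.binomial x y (suc m) (Fin.suc (Fin.inject₁ i)))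
                         (vanish (suc k) ℕ.z<s (subst (ℕ._< m) (sym (Fin.toℕ-inject₁ i)) (Fin.toℕ<n i)))
        where k = toℕ (Fin.inject₁ i)
    last : t (Fin.suc (fromℕ m)) ≡ x ^ suc m
    last = begin
      t (Fin.suc (fromℕ m))                                      ≡⟨ cong term (Fin.toℕ-fromℕ m) ⟩
      term m                                                     ≡⟨ cong₂ (λ c e → c Mult.× (x Exp.^ suc m * y Exp.^ e))
                                                                          (nCn≡1 (suc m)) (ℕ.n∸n≡0 m) ⟩
      (x Exp.^ suc m * 1#) + 0#                                  ≡⟨ trans (+-identityʳ _) (*-identityʳ _) ⟩
      x Exp.^ suc m                                              ≡⟨ ^≡^ x (suc m) ⟨
      x ^ suc m                                                  ∎
      where
      term : ℕ → K
      term k = (suc m C suc k) Mult.× (x Exp.^ suc k * y Exp.^ (m ∸ k))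

module Characteristic (F : FiniteField) (p : ℕ) {{pp : Prime p}} (char : HasChar F p) where
  open FieldProperties F
  open ≡-Reasoning

  1<p : 1 ℕ.< p
  1<p = ℕ.nonTrivial⇒n>1 p {{prime⇒nonTrivial pp}}

  p∣⇒×1≡0 : ∀ {m} → p ∣ m → m ×1 ≡ 0#
  p∣⇒×1≡0 (divides c refl) = trans (×1-homo-* c p) (trans (cong (c ×1 *_) char) (zeroʳ _))

  ×1-nonzero : ∀ m .{{_ : NonZero m}} → m ℕ.< p → m ×1 ≢ 0#
  ×1-nonzero m m<p m≡0 with coprime⇒invertible {m} {p} (Coprime.sym (Coprime.prime⇒coprime pp m<p))
  ... | e , k , me≡1+kp = 0≢1 (begin
    0#                    ≡⟨ zeroˡ (e ×1) ⟨
    0# * e ×1             ≡⟨ cong (_* e ×1) m≡0 ⟨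
    m ×1 * e ×1           ≡⟨ ×1-homo-* m e ⟨
    (m ℕ.* e) ×1          ≡⟨ cong _×1 me≡1+kp ⟩
    1# + (k ℕ.* p) ×1     ≡⟨ cong (1# +_) (p∣⇒×1≡0 (n∣m*n k)) ⟩
    1# + 0#               ≡⟨ +-identityʳ 1# ⟩
    1#                    ∎)

  ×1-%p : ∀ m → m ×1 ≡ (m % p) ×1
  ×1-%p m = begin
    m ×1                                ≡⟨ cong _×1 (m≡m%n+[m/n]*n m p) ⟩
    (m % p ℕ.+ (m / p) ℕ.* p) ×1        ≡⟨ ×1-homo-+ (m % p) _ ⟩
    (m % p) ×1 + ((m / p) ℕ.* p) ×1     ≡⟨ cong ((m % p) ×1 +_) (p∣⇒×1≡0 (n∣m*n (m / p))) ⟩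
    (m % p) ×1 + 0#                     ≡⟨ +-identityʳ _ ⟩
    (m % p) ×1                          ∎

  <⇒×1≢ : ∀ {r s} → r ℕ.< s → s ℕ.< p → r ×1 ≢ s ×1
  <⇒×1≢ {r} {s} r<s s<p r≡s = ×1-nonzero (s ∸ r) {{ℕ.>-nonZero (ℕ.m<n⇒0<n∸m r<s)}}
    (ℕ.≤-<-trans (ℕ.m∸n≤m s r) s<p)
    (x+y≡x⇒y≡0 (begin
      r ×1 + (s ∸ r) ×1     ≡⟨ ×1-homo-+ r (s ∸ r) ⟨
      (r ℕ.+ (s ∸ r)) ×1    ≡⟨ cong _×1 (ℕ.m+[n∸m]≡n (ℕ.<⇒≤ r<s)) ⟩
      s ×1                  ≡⟨ r≡s ⟨
      r ×1                  ∎))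

  ×1-injective : ∀ {r s} → r ℕ.< p → s ℕ.< p → r ×1 ≡ s ×1 → r ≡ s
  ×1-injective {r} {s} r<p s<p r≡s with ℕ.<-cmp r s
  ... | tri< r<s _ _ = ⊥-elim (<⇒×1≢ r<s s<p r≡s)
  ... | tri≈ _ r≡s _ = r≡s
  ... | tri> _ _ s<r = ⊥-elim (<⇒×1≢ s<r r<p (sym r≡s))

  ×1≡⇒%≡ : ∀ a b → a ×1 ≡ b ×1 → a % p ≡ b % p
  ×1≡⇒%≡ a b a≡b = ×1-injective (m%n<n a p) (m%n<n b p) (trans (sym (×1-%p a)) (trans a≡b (×1-%p b)))

  p∤m! : ∀ m → m ℕ.< p → ¬ p ∣ m !
  p∤m! zero    _   p∣1 = ℕ.<⇒≱ 1<p (∣⇒≤ p∣1)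
  p∤m! (suc m) m<p p∣m! with euclidsLemma (suc m) (m !) pp p∣m!
  ... | inj₁ p∣m+1 = ℕ.<⇒≱ m<p (∣⇒≤ p∣m+1)
  ... | inj₂ p∣m!  = p∤m! m (ℕ.<-trans (ℕ.n<1+n m) m<p) p∣m!

  p∣p! : p ∣ p !
  p∣p! = subst (λ n → n ∣ n !) (ℕ.suc-pred p) (m∣m*n (ℕ.pred p !))

  pCk*k![p∸k]!≡p! : ∀ {k} → k ℕ.≤ p → (p C k) ℕ.* (k ! ℕ.* (p ∸ k) !) ≡ p !
  pCk*k![p∸k]!≡p! {k} k≤p = begin
    (p C k) ℕ.* (k ! ℕ.* (p ∸ k) !)
      ≡⟨ cong (ℕ._* (k ! ℕ.* (p ∸ k) !)) (nCk≡n!/k![n-k]! k≤p) ⟩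
    (p ! / (k ! ℕ.* (p ∸ k) !)) {{ℕ._!*_!≢0 k (p ∸ k)}} ℕ.* (k ! ℕ.* (p ∸ k) !)
      ≡⟨ m/n*n≡m {{ℕ._!*_!≢0 k (p ∸ k)}} (k![n∸k]!∣n! k≤p) ⟩
    p !
      ∎

  p∣pCk : ∀ k → 0 ℕ.< k → k ℕ.< p → p ∣ p C k
  p∣pCk k 0<k k<p with euclidsLemma (p C k) (k ! ℕ.* (p ∸ k) !) pp
                         (subst (p ∣_) (sym (pCk*k![p∸k]!≡p! (ℕ.<⇒≤ k<p))) p∣p!)
  ... | inj₁ p∣pCk = p∣pCk
  ... | inj₂ p∣k![p∸k]! with euclidsLemma (k !) ((p ∸ k) !) pp p∣k![p∸k]!
  ...   | inj₁ p∣k!     = ⊥-elim (p∤m! k k<p p∣k!)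
  ...   | inj₂ p∣[p∸k]! = ⊥-elim (p∤m! (p ∸ k) (ℕ.∸-monoʳ-< 0<k (ℕ.<⇒≤ k<p)) p∣[p∸k]!)

  frobenius : ∀ x y → (x + y) ^ p ≡ x ^ p + y ^ p
  frobenius x y = subst (λ q → (x + y) ^ q ≡ x ^ q + y ^ q) (ℕ.suc-pred p)
    (^-additive (ℕ.pred p) vanish x y)
    where
    vanish : ∀ k → 0 ℕ.< k → k ℕ.≤ ℕ.pred p → (suc (ℕ.pred p) C k) ×1 ≡ 0#
    vanish k 0<k k≤p-1 = subst (λ q → (q C k) ×1 ≡ 0#) (sym (ℕ.suc-pred p))
      (p∣⇒×1≡0 (p∣pCk k 0<k (ℕ.m≤pred[n]⇒suc[m]≤n k≤p-1)))

  0^p^i : ∀ i → 0# ^ (p ℕ.^ i) ≡ 0#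
  0^p^i i = subst (λ e → 0# ^ e ≡ 0#) (ℕ.suc-pred (p ℕ.^ i) {{ℕ.m^n≢0 p i}}) (0^suc (ℕ.pred (p ℕ.^ i)))

  frobeniusⁱ : ∀ i x y → (x + y) ^ (p ℕ.^ i) ≡ x ^ (p ℕ.^ i) + y ^ (p ℕ.^ i)
  frobeniusⁱ zero    x y = trans (*-identityʳ _) (sym (cong₂ _+_ (*-identityʳ x) (*-identityʳ y)))
  frobeniusⁱ (suc i) x y = begin
    (x + y) ^ (p ℕ.* p ℕ.^ i)                   ≡⟨ ^-assocʳ (x + y) p (p ℕ.^ i) ⟨
    ((x + y) ^ p) ^ (p ℕ.^ i)                   ≡⟨ cong (_^ (p ℕ.^ i)) (frobenius x y) ⟩
    (x ^ p + y ^ p) ^ (p ℕ.^ i)                 ≡⟨ frobeniusⁱ i (x ^ p) (y ^ p) ⟩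
    (x ^ p) ^ (p ℕ.^ i) + (y ^ p) ^ (p ℕ.^ i)   ≡⟨ cong₂ _+_ (^-assocʳ x p (p ℕ.^ i)) (^-assocʳ y p (p ℕ.^ i)) ⟩
    x ^ (p ℕ.* p ℕ.^ i) + y ^ (p ℕ.* p ℕ.^ i)   ∎

  frobeniusⁱ-neg : ∀ i x → (- x) ^ (p ℕ.^ i) ≡ - (x ^ (p ℕ.^ i))
  frobeniusⁱ-neg i x = begin
    (- x) ^ q                      ≡⟨ solve 2 (λ a b → a := (b :+ a) :- b) refl ((- x) ^ q) (x ^ q) ⟩
    (x ^ q + (- x) ^ q) - (x ^ q)  ≡⟨ cong (_- (x ^ q)) (frobeniusⁱ i x (- x)) ⟨
    ((x + - x) ^ q) - (x ^ q)      ≡⟨ cong (λ t → (t ^ q) - (x ^ q)) (-‿inverseʳ x) ⟩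
    (0# ^ q) - (x ^ q)             ≡⟨ cong (_- (x ^ q)) (0^p^i i) ⟩
    0# - (x ^ q)                   ≡⟨ +-identityˡ _ ⟩
    - (x ^ q)                      ∎
    where q = p ℕ.^ i

  fermat-×1 : ∀ k → (k ×1) ^ p ≡ k ×1
  fermat-×1 zero    = subst (λ e → 0# ^ e ≡ 0#) (ℕ.*-identityʳ p) (0^p^i 1)
  fermat-×1 (suc k) = trans (frobenius 1# (k ×1)) (cong₂ _+_ (1^ p) (fermat-×1 k))

module Polynomials (F : FiniteField) where
  open FieldProperties F
  open ≡-Reasoning

  poly : ∀ {m} → Vec K m → K → K
  poly []       x = 0#
  poly (a ∷ as) x = a + x * poly as x

  monic : ∀ {m} → Vec K m → K → K
  monic []       x = 1#
  monic (a ∷ as) x = a + x * monic as x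

  monic≡poly+xᵐ : ∀ {m} (c : Vec K m) x → monic c x ≡ poly c x + x ^ m
  monic≡poly+xᵐ []       x = sym (+-identityˡ 1#)
  monic≡poly+xᵐ {suc m} (a ∷ as) x = begin
    a + x * monic as x                ≡⟨ cong (λ t → a + x * t) (monic≡poly+xᵐ as x) ⟩
    a + x * (poly as x + x ^ m)       ≡⟨ solve 4 (λ a x v w → a :+ x :* (v :+ w) := (a :+ x :* v) :+ x :* w) refl a x (poly as x) (x ^ m) ⟩
    (a + x * poly as x) + x * x ^ m   ∎

  -- Synthetic division by x - r.
  quotient : ∀ {m} → K → Vec K (suc m) → Vec K m
  quotient r (a ∷ [])     = []
  quotient r (a ∷ b ∷ cs) = monic (b ∷ cs) r ∷ quotient r (b ∷ cs)

  monic-quotient : ∀ {m} r (c : Vec K (suc m)) x → monic c x ≡ monic c r + (x - r) * monic (quotient r c) x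
  monic-quotient r (a ∷ []) x = solve 4 (λ a x r o → a :+ x :* o := (a :+ r :* o) :+ (x :- r) :* o) refl a x r 1#
  monic-quotient r (a ∷ b ∷ cs) x = begin
    a + x * M x                          ≡⟨ cong (λ t → a + x * t) (monic-quotient r (b ∷ cs) x) ⟩
    a + x * (M r + (x - r) * Q)          ≡⟨ solve 5 (λ a x r m q → a :+ x :* (m :+ (x :- r) :* q) := (a :+ r :* m) :+ (x :- r) :* (m :+ x :* q))
                                             refl a x r (M r) Q ⟩
    (a + r * M r) + (x - r) * (M r + x * Q) ∎
    where
    M = monic (b ∷ cs)
    Q = monic (quotient r (b ∷ cs)) x

  monic-root-bound : ∀ m (c : Vec K m) {xs} → Unique xs → (∀ x → x ∈ xs → monic c x ≡ 0#) → length xs ℕ.≤ m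
  monic-root-bound zero    []  {[]}    _ _     = z≤n
  monic-root-bound zero    []  {x ∷ _} _ roots = ⊥-elim (0≢1 (sym (roots x (here refl))))
  monic-root-bound (suc m) c   {[]}    _ _     = z≤n
  monic-root-bound (suc m) c   {r ∷ xs} (r∉xs ∷ u) roots = s≤s (monic-root-bound m (quotient r c) u quotient-roots)
    where
    quotient-roots : ∀ x → x ∈ xs → monic (quotient r c) x ≡ 0#
    quotient-roots x x∈xs with *-integral {x - r} {monic (quotient r c) x} (begin
      (x - r) * monic (quotient r c) x               ≡⟨ +-identityˡ _ ⟨
      0# + (x - r) * monic (quotient r c) x          ≡⟨ cong (λ t → t + (x - r) * monic (quotient r c) x) (roots r (here refl)) ⟨
      monic c r + (x - r) * monic (quotient r c) x   ≡⟨ monic-quotient r c x ⟨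
      monic c x                                      ≡⟨ roots x (there x∈xs) ⟩
      0#                                             ∎)
    ... | inj₁ x-r≡0 = ⊥-elim (All.lookup r∉xs x∈xs (sym (x-y≡0⇒x≡y x-r≡0)))
    ... | inj₂ q≡0   = q≡0

  DegreeBelow : ℕ → (K → K) → Set
  DegreeBelow D f = Σ (Vec K D) λ c → ∀ x → poly c x ≡ f x

  root-bound : ∀ {D f} → DegreeBelow D f → {xs : List K} → Unique xs →
               (∀ x → x ∈ xs → f x + x ^ D ≡ 0#) → length xs ℕ.≤ D
  root-bound {D} {f} (c , poly≡f) u roots =
    monic-root-bound D c u (λ x x∈ → trans (monic≡poly+xᵐ c x) (trans (cong (_+ x ^ D) (poly≡f x)) (roots x x∈)))

  degreeBelow-cong : ∀ {D f g} → (∀ x → f x ≡ g x) → DegreeBelow D f → DegreeBelow D g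
  degreeBelow-cong f≡g (c , poly≡f) = c , λ x → trans (poly≡f x) (f≡g x)

  degreeBelow-0# : ∀ D → DegreeBelow D (λ _ → 0#)
  degreeBelow-0# zero    = [] , λ _ → refl
  degreeBelow-0# (suc D) with degreeBelow-0# D
  ... | c , poly≡0 = 0# ∷ c , λ x → trans (cong (λ t → 0# + x * t) (poly≡0 x)) (trans (+-identityˡ _) (zeroʳ x))

  degreeBelow-+ : ∀ {D f g} → DegreeBelow D f → DegreeBelow D g → DegreeBelow D (λ x → f x + g x)
  degreeBelow-+ {zero}  ([] , f≡) ([] , g≡) = [] , λ x → trans (sym (+-identityˡ 0#)) (cong₂ _+_ (f≡ x) (g≡ x))
  degreeBelow-+ {suc D} (a ∷ as , f≡) (b ∷ bs , g≡) with degreeBelow-+ {D} (as , λ _ → refl) (bs , λ _ → refl)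
  ... | cs , cs≡ = a + b ∷ cs , λ x → begin
    (a + b) + x * poly cs x                         ≡⟨ cong (λ t → (a + b) + x * t) (cs≡ x) ⟩
    (a + b) + x * (poly as x + poly bs x)           ≡⟨ solve 5 (λ a b x u v → (a :+ b) :+ x :* (u :+ v) := (a :+ x :* u) :+ (b :+ x :* v))
                                                        refl a b x (poly as x) (poly bs x) ⟩
    (a + x * poly as x) + (b + x * poly bs x)       ≡⟨ cong₂ _+_ (f≡ x) (g≡ x) ⟩
    _                                               ∎

  degreeBelow-neg : ∀ {D f} → DegreeBelow D f → DegreeBelow D (λ x → - f x)
  degreeBelow-neg {zero}  ([] , f≡) = [] , λ x → trans (sym -0#≈0#) (cong -_ (f≡ x))
  degreeBelow-neg {suc D} (a ∷ as , f≡) with degreeBelow-neg {D} (as , λ _ → refl)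
  ... | cs , cs≡ = - a ∷ cs , λ x → begin
    - a + x * poly cs x          ≡⟨ cong (λ t → - a + x * t) (cs≡ x) ⟩
    - a + x * - poly as x        ≡⟨ solve 3 (λ a x u → :- a :+ x :* (:- u) := :- (a :+ x :* u)) refl a x (poly as x) ⟩
    - (a + x * poly as x)        ≡⟨ cong -_ (f≡ x) ⟩
    _                            ∎

  degreeBelow-^ : ∀ {D e} → e ℕ.< D → DegreeBelow D (_^ e)
  degreeBelow-^ {suc D} {zero}  _ with degreeBelow-0# D
  ... | c , poly≡0 = 1# ∷ c , λ x → trans (cong (λ t → 1# + x * t) (poly≡0 x)) (trans (cong (1# +_) (zeroʳ x)) (+-identityʳ 1#))
  degreeBelow-^ {suc D} {suc e} (s≤s e<D) with degreeBelow-^ {D} {e} e<D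
  ... | c , poly≡xᵉ = 0# ∷ c , λ x → trans (cong (λ t → 0# + x * t) (poly≡xᵉ x)) (+-identityˡ _)

  degreeBelow-Σ^ : ∀ {D} (e : ℕ → ℕ) k → (∀ i → i ℕ.< k → e i ℕ.< D) →
                   DegreeBelow D (λ x → ∑F.sum (λ i → x ^ e i) (upTo k))
  degreeBelow-Σ^ {D} e zero    _     = degreeBelow-0# D
  degreeBelow-Σ^ {D} e (suc k) e<D =
    degreeBelow-cong (λ x → sym (∑F.sum-upTo-∷ʳ (λ i → x ^ e i) k))
      (degreeBelow-+ (degreeBelow-Σ^ e k (λ i i<k → e<D i (ℕ.m<n⇒m<1+n i<k))) (degreeBelow-^ (e<D k ℕ.≤-refl)))

module MultiplicativeGroup (F : FiniteField) where
  open FieldProperties F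
  open ≡-Reasoning

  ∈-units⁺ : ∀ {x} → x ≢ 0# → x ∈ units
  ∈-units⁺ {x} x≢0 = ∈-filter⁺ (λ y → ¬? (y ≟ 0#)) (complete x) x≢0

  ∈-units⁻ : ∀ {x} → x ∈ units → x ≢ 0#
  ∈-units⁻ x∈ = proj₂ (∈-filter⁻ (λ y → ¬? (y ≟ 0#)) {xs = elements} x∈)

  units-unique : Unique units
  units-unique = Unique.filter⁺ (λ y → ¬? (y ≟ 0#)) unique

  size≡1+|units| : size ≡ suc (length units)
  size≡1+|units| = count elements unique (complete 0#)
    where
    count : ∀ xs → Unique xs → 0# ∈ xs → length xs ≡ suc (length (filter (λ y → ¬? (y ≟ 0#)) xs))
    count (y ∷ xs) (y∉xs ∷ _) (here refl) with y ≟ 0#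
    ... | no  y≢0 = ⊥-elim (y≢0 refl)
    ... | yes _   = cong suc (cong length (sym (List.filter-all (λ y → ¬? (y ≟ 0#))
                      (All.tabulate (λ z∈ z≡0 → All.lookup y∉xs z∈ (sym z≡0))))))
    count (y ∷ xs) (y∉xs ∷ u) (there 0∈xs) with y ≟ 0#
    ... | no  _   = cong suc (count xs u 0∈xs)
    ... | yes y≡0 = ⊥-elim (All.lookup y∉xs 0∈xs y≡0)

  ∏-*ˡ : ∀ x xs → ∏F.sum (x *_) xs ≡ x ^ length xs * ∏F.sum (λ u → u) xs
  ∏-*ˡ x []       = sym (*-identityʳ 1#)
  ∏-*ˡ x (u ∷ xs) = trans (cong ((x * u) *_) (∏-*ˡ x xs))
    (solve 4 (λ x u a b → (x :* u) :* (a :* b) := (x :* a) :* (u :* b)) refl x u (x ^ length xs) (∏F.sum (λ u → u) xs))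

  ∏-nonzero : ∀ xs → (∀ u → u ∈ xs → u ≢ 0#) → ∏F.sum (λ u → u) xs ≢ 0#
  ∏-nonzero []       _      1≡0 = 0≢1 (sym 1≡0)
  ∏-nonzero (u ∷ xs) u≢0 = *-nonzero (u≢0 u (here refl)) (∏-nonzero xs (λ v → u≢0 v ∘ there))

  -- Multiplication by x permutes the units, so x^|units| times their product is their product.
  x^|units|≡1 : ∀ x → x ≢ 0# → x ^ length units ≡ 1#
  x^|units|≡1 x x≢0 = *-cancelˡ (∏-nonzero units (λ _ → ∈-units⁻)) (begin
    P * x ^ length units     ≡⟨ *-comm P _ ⟩
    x ^ length units * P     ≡⟨ ∏-*ˡ x units ⟨
    ∏F.sum (x *_) units      ≡⟨ ∏F.sum-reindex _≟_ units-unique (x *_) (x⁻¹ *_)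
                                 (λ y y∈ → ∈-units⁺ (*-nonzero x≢0 (∈-units⁻ y∈)))
                                 (λ y y∈ → ∈-units⁺ (*-nonzero x⁻¹≢0 (∈-units⁻ y∈)))
                                 (λ y _ → cancel (*-inverseˡ x x≢0) y) (λ y _ → cancel (*-inverseʳ x x≢0) y) (λ u → u) ⟩
    P                        ≡⟨ *-identityʳ P ⟨
    P * 1#                   ∎)
    where
    P = ∏F.sum (λ u → u) units
    x⁻¹ = inv x x≢0
    x⁻¹≢0 : x⁻¹ ≢ 0#
    x⁻¹≢0 x⁻¹≡0 = 0≢1 (trans (sym (trans (cong (x *_) x⁻¹≡0) (zeroʳ x))) (*-inverseʳ x x≢0))
    cancel : ∀ {a b} → a * b ≡ 1# → ∀ y → a * (b * y) ≡ y
    cancel {a} {b} ab≡1 y = trans (sym (*-assoc a b y)) (trans (cong (_* y) ab≡1) (*-identityˡ y))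

  fermat : ∀ x → x ^ suc (length units) ≡ x
  fermat x with x ≟ 0#
  ... | yes refl = zeroˡ _
  ... | no  x≢0  = trans (cong (x *_) (x^|units|≡1 x x≢0)) (*-identityʳ x)

  fermat-* : ∀ m x → x ^ suc (m ℕ.* length units) ≡ x
  fermat-* zero    x = *-identityʳ x
  fermat-* (suc m) x = begin
    x ^ suc (length units ℕ.+ m ℕ.* length units)    ≡⟨ cong (x ^_) (ℕ.+-suc (length units) _) ⟨
    x ^ (length units ℕ.+ suc (m ℕ.* length units))  ≡⟨ ^-homo-* x (length units) _ ⟩
    x ^ length units * x ^ suc (m ℕ.* length units)  ≡⟨ cong (x ^ length units *_) (fermat-* m x) ⟩
    x ^ length units * x                             ≡⟨ *-comm _ x ⟩
    x ^ suc (length units)                           ≡⟨ fermat x ⟩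
    x                                                ∎

  power-inverse : ∀ d .{{_ : NonZero d}} → Coprime d (length units) →
                  ∃ λ e → (∀ x → (x ^ d) ^ e ≡ x) × (∀ x → (x ^ e) ^ d ≡ x)
  power-inverse d cop with coprime⇒invertible cop
  ... | e , m , de≡1+m|U| = e
      , (λ x → trans (^-assocʳ x d e) (trans (cong (x ^_) de≡1+m|U|) (fermat-* m x)))
      , (λ x → trans (^-assocʳ x e d) (trans (cong (x ^_) (trans (ℕ.*-comm e d) de≡1+m|U|)) (fermat-* m x)))

-- The prime subfield and the trace

module PrimeSubfield (F : FiniteField) (p : ℕ) {{pp : Prime p}} (char : HasChar F p) where
  open FieldProperties F
  open Characteristic F p char
  open Polynomials F
  open DecMembership _≟_ using (_∈?_)

  -- `toFp` searches `allFin p` with a local function; `search` is that function, bound by unification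
  -- in `toFp≡search`, so that `search-sound` can reason about it by induction on the list.
  mutual
    private
      search : K → List (Fin p) → Fin p
      search = _

      toFp≡search : ∀ t → toFp F p t ≡ search t (allFin p)
      toFp≡search t with allFin p
      ... | ks = refl

      search-sound : ∀ t {k} ks → k ∈ ks → toℕ k ×1 ≡ t → toℕ (search t ks) ×1 ≡ t
      search-sound t (k′ ∷ ks) k∈ k≡t with (toℕ k′ ×1) ≟ t
      ... | yes k′≡t = k′≡t
      search-sound t (k′ ∷ ks) (here refl) k≡t | no k′≢t = ⊥-elim (k′≢t k≡t)
      search-sound t (k′ ∷ ks) (there k∈) k≡t  | no _     = search-sound t ks k∈ k≡t

  toFp-sound : ∀ t (k : Fin p) → toℕ k ×1 ≡ t → toℕ (toFp F p t) ×1 ≡ t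
  toFp-sound t k k≡t = subst (λ s → toℕ s ×1 ≡ t) (sym (toFp≡search t)) (search-sound t (allFin p) (∈-allFin k) k≡t)

  prime-field : List K
  prime-field = map (λ k → toℕ k ×1) (allFin p)

  prime-field-unique : Unique prime-field
  prime-field-unique = Unique.map⁺ (λ {k} {k′} k≡k′ → Fin.toℕ-injective (×1-injective (Fin.toℕ<n k) (Fin.toℕ<n k′) k≡k′))
                                  (Unique.allFin⁺ p)

  length-prime-field : length prime-field ≡ p
  length-prime-field = trans (List.length-map _ (allFin p)) (List.length-tabulate (λ i → i))

  -- The p elements k·1 are roots of x^p - x, so there is no room for another root.
  fixed-by-^p⇒∈prime-field : ∀ t → t ^ p ≡ t → ∃ λ (k : Fin p) → toℕ k ×1 ≡ t
  fixed-by-^p⇒∈prime-field t t^p≡t with t ∈? prime-field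
  ... | yes t∈ with ∈-map⁻ (λ k → toℕ k ×1) t∈
  ...   | k , _ , t≡k = k , sym t≡k
  fixed-by-^p⇒∈prime-field t t^p≡t | no t∉ = ⊥-elim (ℕ.n≮n p (subst (λ l → suc l ℕ.≤ p) length-prime-field
      (root-bound (degreeBelow-neg (degreeBelow-^ {p} {1} 1<p)) (t∉prime-field ∷ prime-field-unique) roots)))
    where
    t∉prime-field : All (t ≢_) prime-field
    t∉prime-field = All.tabulate (λ y∈ t≡y → t∉ (subst (_∈ prime-field) (sym t≡y) y∈))
    root : ∀ y → y ^ p ≡ y → - (y ^ 1) + y ^ p ≡ 0#
    root y y^p≡y = trans (cong₂ (λ a b → - a + b) (*-identityʳ y) y^p≡y) (-‿inverseˡ y)
    roots : ∀ x → x ∈ t ∷ prime-field → - (x ^ 1) + x ^ p ≡ 0#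
    roots x (here refl) = root x t^p≡t
    roots x (there x∈) with ∈-map⁻ (λ k → toℕ k ×1) x∈
    ... | k , _ , refl = root _ (fermat-×1 (toℕ k))

module Trace (F : FiniteField) (p n : ℕ) {{pp : Prime p}} (char : HasChar F p) (card≡pⁿ : card F ≡ p ℕ.^ n) where
  open FieldProperties F
  open Characteristic F p char
  open Polynomials F
  open MultiplicativeGroup F
  open PrimeSubfield F p char
  open ≡-Reasoning

  pⁿ≡1+|units| : p ℕ.^ n ≡ suc (length units)
  pⁿ≡1+|units| = trans (sym card≡pⁿ) size≡1+|units|

  x^pⁿ≡x : ∀ x → x ^ (p ℕ.^ n) ≡ x
  x^pⁿ≡x x = trans (cong (x ^_) pⁿ≡1+|units|) (fermat x)

  tr : K → K
  tr x = ∑F.sum (λ i → x ^ (p ℕ.^ i)) (upTo n)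

  TrF≡tr : ∀ x → TrF F p n x ≡ tr x
  TrF≡tr x = ∑F.foldr-map (λ i → x ^ (p ℕ.^ i)) (upTo n)

  tr-+ : ∀ x y → tr (x + y) ≡ tr x + tr y
  tr-+ x y = trans (∑F.sum-cong′ (upTo n) (λ i → frobeniusⁱ i x y)) (∑F.sum-∙ _ _ (upTo n))

  tr-0# : tr 0# ≡ 0#
  tr-0# = ∑F.sum-zero (upTo n) (λ i _ → 0^p^i i)

  tr-×1* : ∀ j c → tr (j ×1 * c) ≡ j ×1 * tr c
  tr-×1* zero    c = trans (cong tr (zeroˡ c)) (trans tr-0# (sym (zeroˡ _)))
  tr-×1* (suc j) c = begin
    tr ((1# + j ×1) * c)        ≡⟨ cong tr (trans (distribʳ c 1# (j ×1)) (cong (_+ j ×1 * c) (*-identityˡ c))) ⟩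
    tr (c + j ×1 * c)           ≡⟨ tr-+ c _ ⟩
    tr c + tr (j ×1 * c)        ≡⟨ cong (tr c +_) (tr-×1* j c) ⟩
    tr c + j ×1 * tr c          ≡⟨ cong (_+ j ×1 * tr c) (*-identityˡ (tr c)) ⟨
    1# * tr c + j ×1 * tr c     ≡⟨ distribʳ (tr c) 1# (j ×1) ⟨
    (1# + j ×1) * tr c          ∎

  ∑-frobenius : ∀ {X : Set} (g : X → K) xs → ∑F.sum g xs ^ p ≡ ∑F.sum (λ i → g i ^ p) xs
  ∑-frobenius g []       = subst (λ e → 0# ^ e ≡ 0#) (ℕ.*-identityʳ p) (0^p^i 1)
  ∑-frobenius g (i ∷ xs) = trans (frobenius (g i) _) (cong (g i ^ p +_) (∑-frobenius g xs))

  -- The p-th power map permutes the conjugates x^(p^i) cyclically.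
  tr-^p : ∀ x → tr x ^ p ≡ tr x
  tr-^p x = begin
    tr x ^ p                                      ≡⟨ ∑-frobenius (λ i → x ^ (p ℕ.^ i)) (upTo n) ⟩
    ∑F.sum (λ i → (x ^ (p ℕ.^ i)) ^ p) (upTo n)   ≡⟨ ∑F.sum-cong′ (upTo n) (λ i →
                                                       trans (^-assocʳ x (p ℕ.^ i) p) (cong (x ^_) (ℕ.*-comm (p ℕ.^ i) p))) ⟩
    ∑F.sum (λ i → x ^ (p ℕ.^ suc i)) (upTo n)     ≡⟨ ∑F.sum-upTo-rotate (λ i → x ^ (p ℕ.^ i)) n
                                                       (trans (x^pⁿ≡x x) (sym (*-identityʳ x))) ⟩
    tr x                                          ∎

  τ : K → ℕ
  τ x = toℕ (Tr F p n x)

  τ-×1 : ∀ x → τ x ×1 ≡ tr x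
  τ-×1 x with fixed-by-^p⇒∈prime-field (TrF F p n x) (trans (cong (_^ p) (TrF≡tr x)) (trans (tr-^p x) (sym (TrF≡tr x))))
  ... | k , k≡ = trans (toFp-sound (TrF F p n x) k k≡) (TrF≡tr x)

  τ-+ : ∀ x y → τ (x + y) % p ≡ (τ x ℕ.+ τ y) % p
  τ-+ x y = ×1≡⇒%≡ _ _ (begin
    τ (x + y) ×1              ≡⟨ τ-×1 (x + y) ⟩
    tr (x + y)                ≡⟨ tr-+ x y ⟩
    tr x + tr y               ≡⟨ cong₂ _+_ (τ-×1 x) (τ-×1 y) ⟨
    τ x ×1 + τ y ×1           ≡⟨ ×1-homo-+ (τ x) (τ y) ⟨
    (τ x ℕ.+ τ y) ×1          ∎)

  τ-0# : τ 0# % p ≡ 0 % p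
  τ-0# = ×1≡⇒%≡ _ _ (trans (τ-×1 0#) tr-0#)

  τ-×1* : ∀ j c → τ (j ×1 * c) % p ≡ (j ℕ.* τ c) % p
  τ-×1* j c = ×1≡⇒%≡ _ _ (begin
    τ (j ×1 * c) ×1           ≡⟨ τ-×1 (j ×1 * c) ⟩
    tr (j ×1 * c)             ≡⟨ tr-×1* j c ⟩
    j ×1 * tr c               ≡⟨ cong (j ×1 *_) (τ-×1 c) ⟨
    j ×1 * τ c ×1             ≡⟨ ×1-homo-* j (τ c) ⟨
    (j ℕ.* τ c) ×1            ∎)

  -- tr is a polynomial of degree p^(n-1) < q, so it cannot vanish on all q elements.
  tr-nonzero : ∃ λ c → tr c ≢ 0#
  tr-nonzero with all? (λ x → tr x ≟ 0#) elements
  ... | no ¬all = Any.satisfied (¬All⇒Any¬ (λ x → tr x ≟ 0#) elements ¬all)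
  ... | yes all = ⊥-elim (too-many-roots n refl)
    where
    2≤size : 2 ℕ.≤ size
    2≤size = subst (2 ℕ.≤_) (sym size≡1+|units|) (s≤s (nonempty (∈-units⁺ {1#} (0≢1 ∘ sym))))
      where
      nonempty : ∀ {x} {xs : List K} → x ∈ xs → 1 ℕ.≤ length xs
      nonempty (here _)  = s≤s z≤n
      nonempty (there _) = s≤s z≤n
    too-many-roots : ∀ m → m ≡ n → ⊥
    too-many-roots zero    refl = ℕ.<⇒≱ 2≤size (ℕ.≤-reflexive card≡pⁿ)
    too-many-roots (suc m) refl = ℕ.<⇒≱ (ℕ.^-monoʳ-< p 1<p (ℕ.n<1+n m)) (subst (ℕ._≤ p ℕ.^ m) card≡pⁿ
      (root-bound (degreeBelow-Σ^ (p ℕ.^_) m (λ i i<m → ℕ.^-monoʳ-< p 1<p i<m)) unique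
        (λ x x∈ → trans (sym (∑F.sum-upTo-∷ʳ (λ i → x ^ (p ℕ.^ i)) m)) (All.lookup all x∈))))

  -- Scale c by an inverse of Tr c modulo p.
  τ≢0⇒∃τ≡1 : ∀ c → τ c % p ≢ 0 → ∃ λ c′ → τ c′ % p ≡ 1 % p
  τ≢0⇒∃τ≡1 c t≢0 with coprime⇒invertible {τ c % p} {p} {{ℕ.≢-nonZero t≢0}}
                         (Coprime.sym (Coprime.prime⇒coprime pp {{ℕ.≢-nonZero t≢0}} (m%n<n (τ c) p)))
  ... | e , m , te≡1+mp = e ×1 * c , (begin
    τ (e ×1 * c) % p                 ≡⟨ τ-×1* e c ⟩
    (e ℕ.* τ c) % p                  ≡⟨ cong (_% p) (ℕ.*-comm e (τ c)) ⟩
    (τ c ℕ.* e) % p                  ≡⟨ %-distribˡ-* (τ c) e p ⟩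
    (τ c % p ℕ.* (e % p)) % p        ≡⟨ cong (λ a → (a ℕ.* (e % p)) % p) (m%n%n≡m%n (τ c) p) ⟨
    (τ c % p % p ℕ.* (e % p)) % p    ≡⟨ %-distribˡ-* (τ c % p) e p ⟨
    (τ c % p ℕ.* e) % p              ≡⟨ cong (_% p) te≡1+mp ⟩
    suc (m ℕ.* p) % p                ≡⟨ [m+kn]%n≡m%n 1 m p ⟩
    1 % p                            ∎)

  ∃τ≡1 : ∃ λ c → τ c % p ≡ 1 % p
  ∃τ≡1 with tr-nonzero
  ... | c , trc≢0 = τ≢0⇒∃τ≡1 c (λ t≡0 → trc≢0 (trans (sym (τ-×1 c)) (trans (×1-%p (τ c)) (cong _×1 t≡0))))

-- Character sums

module CharacterSums (F : FiniteField) (p n : ℕ) {{pp : Prime p}} (char : HasChar F p) (card≡pⁿ : card F ≡ p ℕ.^ n) where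
  open FieldProperties F
  open Trace F p n char card≡pⁿ
  open Cyclotomic p

  Ψ : K → Cyc p
  Ψ = ψ F p n

  ∑ : (K → Cyc p) → Cyc p
  ∑ f = sumᶜ f elements

  ∑³ : (K → K → K → Cyc p) → Cyc p
  ∑³ G = ∑ λ x₁ → ∑ λ x₂ → ∑ λ x₃ → G x₁ x₂ x₃

  ∑⁴ : (K → K → K → K → Cyc p) → Cyc p
  ∑⁴ G = ∑ λ x₁ → ∑³ (G x₁)

  ∑³-cong : ∀ {G H} → (∀ x₁ x₂ x₃ → G x₁ x₂ x₃ ≗ H x₁ x₂ x₃) → ∑³ G ≗ ∑³ H
  ∑³-cong G≗H = sumᶜ-cong elements λ x₁ → sumᶜ-cong elements λ x₂ → sumᶜ-cong elements (G≗H x₁ x₂)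

  ∑³-cong≈ : ∀ {G H} → (∀ x₁ x₂ x₃ → G x₁ x₂ x₃ ≈ H x₁ x₂ x₃) → ∑³ G ≈ ∑³ H
  ∑³-cong≈ G≈H = sumᶜ-cong≈ elements λ x₁ _ → sumᶜ-cong≈ elements λ x₂ _ → sumᶜ-cong≈ elements λ x₃ _ → G≈H x₁ x₂ x₃

  ∑⁴-cong : ∀ {G H} → (∀ x₁ x₂ x₃ x₄ → G x₁ x₂ x₃ x₄ ≗ H x₁ x₂ x₃ x₄) → ∑⁴ G ≗ ∑⁴ H
  ∑⁴-cong G≗H = sumᶜ-cong elements λ x₁ → ∑³-cong (G≗H x₁)

  ·ᶜ-∑³ : ∀ m G → m ·ᶜ ∑³ G ≗ ∑³ (λ x₁ x₂ x₃ → m ·ᶜ G x₁ x₂ x₃)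
  ·ᶜ-∑³ m G j = trans (·ᶜ-sumᶜ m _ elements j) (sumᶜ-cong elements (λ x₁ k →
                  trans (·ᶜ-sumᶜ m _ elements k) (sumᶜ-cong elements (λ x₂ → ·ᶜ-sumᶜ m (G x₁ x₂) elements) k)) j)

  ∑-pull-out⁴ : (G : K → K → K → K → K → Cyc p) →
                ∑ (λ a → ∑⁴ (G a)) ≗ ∑⁴ (λ x₁ x₂ x₃ x₄ → ∑ λ a → G a x₁ x₂ x₃ x₄)
  ∑-pull-out⁴ G = begin
    ∑ (λ a → ∑ λ x₁ → ∑ λ x₂ → ∑ λ x₃ → ∑ λ x₄ → G a x₁ x₂ x₃ x₄)
      ≈⟨ sumᶜ-swap (λ a x₁ → ∑ λ x₂ → ∑ λ x₃ → ∑ λ x₄ → G a x₁ x₂ x₃ x₄) elements elements ⟩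
    ∑ (λ x₁ → ∑ λ a → ∑ λ x₂ → ∑ λ x₃ → ∑ λ x₄ → G a x₁ x₂ x₃ x₄)
      ≈⟨ sumᶜ-cong elements (λ x₁ → sumᶜ-swap (λ a x₂ → ∑ λ x₃ → ∑ λ x₄ → G a x₁ x₂ x₃ x₄) elements elements) ⟩
    ∑ (λ x₁ → ∑ λ x₂ → ∑ λ a → ∑ λ x₃ → ∑ λ x₄ → G a x₁ x₂ x₃ x₄)
      ≈⟨ sumᶜ-cong elements (λ x₁ → sumᶜ-cong elements λ x₂ →
           sumᶜ-swap (λ a x₃ → ∑ λ x₄ → G a x₁ x₂ x₃ x₄) elements elements) ⟩
    ∑ (λ x₁ → ∑ λ x₂ → ∑ λ x₃ → ∑ λ a → ∑ λ x₄ → G a x₁ x₂ x₃ x₄)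
      ≈⟨ sumᶜ-cong elements (λ x₁ → sumᶜ-cong elements λ x₂ → sumᶜ-cong elements λ x₃ →
           sumᶜ-swap (λ a x₄ → G a x₁ x₂ x₃ x₄) elements elements) ⟩
    ∑ (λ x₁ → ∑ λ x₂ → ∑ λ x₃ → ∑ λ x₄ → ∑ λ a → G a x₁ x₂ x₃ x₄)
      ∎
    where open ≗-Reasoning

  Ψ-+ : ∀ x y → Ψ (x + y) ≗ Ψ x *ᶜ Ψ y
  Ψ-+ x y j = trans (ε-cong (τ-+ x y) j) (sym (ε-+ (τ x) (τ y) j))

  ∑-permute : (σ σ⁻¹ : K → K) → (∀ x → σ⁻¹ (σ x) ≡ x) → (∀ y → σ (σ⁻¹ y) ≡ y) →
              (g : K → Cyc p) → ∑ (g ∘ σ) ≗ ∑ g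
  ∑-permute = sumᶜ-bijection _≟_ unique complete

  -- Translating by an element of trace 1 multiplies ∑ Ψ by ζ.
  ∑Ψ≈0 : ∑ Ψ ≈ 0ᶜ
  ∑Ψ≈0 = ζ-invariant⇒≈0 (∑ Ψ) λ j → begin
    ∑ Ψ j                    ≡⟨ ∑-permute (_+ c) (_- c) (λ x → solve 2 (λ x c → (x :+ c) :- c := x) refl x c)
                                              (λ y → solve 2 (λ y c → (y :- c) :+ c := y) refl y c) Ψ j ⟨
    ∑ (λ x → Ψ (x + c)) j    ≡⟨ sumᶜ-cong elements translate j ⟩
    ∑ (λ x → ε 1 *ᶜ Ψ x) j   ≡⟨ *ᶜ-sumᶜʳ (ε 1) Ψ elements j ⟨
    (ε 1 *ᶜ ∑ Ψ) j           ∎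
    where
    open ≡-Reasoning
    c = proj₁ ∃τ≡1
    translate : ∀ x → Ψ (x + c) ≗ ε 1 *ᶜ Ψ x
    translate x k = trans (Ψ-+ x c k) (trans (*ᶜ-comm (Ψ x) (Ψ c) k) (*ᶜ-cong (ε-cong (proj₂ ∃τ≡1)) (λ _ → refl) k))

  ∑Ψ∘permutation≈0 : (σ σ⁻¹ : K → K) → (∀ x → σ⁻¹ (σ x) ≡ x) → (∀ y → σ (σ⁻¹ y) ≡ y) → ∑ (Ψ ∘ σ) ≈ 0ᶜ
  ∑Ψ∘permutation≈0 σ σ⁻¹ inv₁ inv₂ = ≈-trans (≗⇒≈ (∑-permute σ σ⁻¹ inv₁ inv₂ Ψ)) ∑Ψ≈0

  orthogonality : ∀ s → s ≢ 0# → ∑ (λ a → Ψ (a * s)) ≈ 0ᶜ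
  orthogonality s s≢0 = ∑Ψ∘permutation≈0 (_* s) (_* inv s s≢0)
    (λ x → trans (*-assoc x s _) (trans (cong (x *_) (*-inverseʳ s s≢0)) (*-identityʳ x)))
    (λ x → trans (*-assoc x _ s) (trans (cong (x *_) (*-inverseˡ s s≢0)) (*-identityʳ x)))

  orthogonality-0# : ∑ (λ a → Ψ (a * 0#)) ≗ size ·ᶜ ε 0
  orthogonality-0# j = trans (sumᶜ-cong elements (λ a k → trans (cong (λ t → Ψ t k) (zeroʳ a)) (ε-cong τ-0# k)) j)
                             (sumᶜ-const (ε 0) elements j)

  Ψ-*-∑ : ∀ a (g : K → K) → Ψ a *ᶜ ∑ (Ψ ∘ g) ≗ ∑ (λ x → Ψ (a + g x))
  Ψ-*-∑ a g j = trans (*ᶜ-sumᶜʳ (Ψ a) (Ψ ∘ g) elements j) (sumᶜ-cong elements (λ x k → sym (Ψ-+ a (g x) k)) j)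

  Ψ-*-∑∑ : ∀ a (g : K → K → K) → Ψ a *ᶜ ∑ (λ y → ∑ (λ z → Ψ (g y z))) ≗ ∑ (λ y → ∑ (λ z → Ψ (a + g y z)))
  Ψ-*-∑∑ a g j = trans (*ᶜ-sumᶜʳ (Ψ a) _ elements j) (sumᶜ-cong elements (λ y → Ψ-*-∑ a (g y)) j)

  Ψ-*-∑³ : ∀ a (g : K → K → K → K) → Ψ a *ᶜ ∑³ (λ x y z → Ψ (g x y z)) ≗ ∑³ (λ x y z → Ψ (a + g x y z))
  Ψ-*-∑³ a g j = trans (*ᶜ-sumᶜʳ (Ψ a) _ elements j) (sumᶜ-cong elements (λ x → Ψ-*-∑∑ a (g x)) j)

  ∑Ψ-* : ∀ (f : K → K) u (G : K → Cyc p) → (∀ x → Ψ (f x) *ᶜ u ≗ G x) → ∑ (Ψ ∘ f) *ᶜ u ≗ ∑ G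
  ∑Ψ-* f u G eq j = trans (*ᶜ-sumᶜˡ u (Ψ ∘ f) elements j) (sumᶜ-cong elements eq j)

module FourthMoment (F : FiniteField) (p n r : ℕ) {{pp : Prime p}} (char : HasChar F p) (card≡pⁿ : card F ≡ p ℕ.^ n)
                    (d-coprime : gcd (2 ℕ.+ p ℕ.^ r) (p ℕ.^ n ℕ.∸ 1) ≡ 1) where
  open FieldProperties F
  open Characteristic F p char
  open MultiplicativeGroup F
  open Trace F p n char card≡pⁿ
  open Cyclotomic p
  open CharacterSums F p n char card≡pⁿ

  d : ℕ
  d = 2 ℕ.+ p ℕ.^ r

  h : K → K → K
  h a x = (x ^ d) - (a * x)

  W₀≈0 : W F p n d 0# ≈ 0ᶜ
  W₀≈0 = ≈-trans (≗⇒≈ (sumᶜ-cong elements (λ x k → cong (λ t → Ψ t k) (h₀ x))))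
                 (∑Ψ∘permutation≈0 (_^ d) (_^ e) x^d^e≡x x^e^d≡x)
    where
    h₀ : ∀ x → h 0# x ≡ x ^ d
    h₀ x = trans (cong (λ t → (x ^ d) - t) (zeroˡ x)) (trans (cong ((x ^ d) +_) -0#≈0#) (+-identityʳ _))
    inverse-exponent = power-inverse d (gcd≡1⇒coprime (subst (λ m → gcd d m ≡ 1) (cong (ℕ._∸ 1) pⁿ≡1+|units|) d-coprime))
    e = proj₁ inverse-exponent
    x^d^e≡x = proj₁ (proj₂ inverse-exponent)
    x^e^d≡x = proj₂ (proj₂ inverse-exponent)

  ∑ˣW⁴≈∑W⁴ : sumᶜ (λ a → W F p n d a ^4) (elemsˣ F) ≈ ∑ (λ a → W F p n d a ^4)
  ∑ˣW⁴≈∑W⁴ = sumᶜ-filter (λ y → ¬? (y ≟ 0#)) _ elements zero-term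
    where
    zero-term : ∀ a → ¬ a ≢ 0# → W F p n d a ^4 ≈ 0ᶜ
    zero-term a a≢0⇒⊥ with a ≟ 0#
    ... | yes refl = u≈0⇒u*v≈0 _ W₀≈0
    ... | no  a≢0  = ⊥-elim (a≢0⇒⊥ a≢0)

  D : K → K → K → K → K
  D x₁ x₂ x₃ x₄ = x₁ ^ d + (x₂ ^ d + (x₃ ^ d + x₄ ^ d))

  s : K → K → K → K → K
  s x₁ x₂ x₃ x₄ = - (x₁ + (x₂ + (x₃ + x₄)))

  W⁴-expand : ∀ a → W F p n d a ^4 ≗ ∑⁴ (λ x₁ x₂ x₃ x₄ → Ψ (D x₁ x₂ x₃ x₄) *ᶜ Ψ (a * s x₁ x₂ x₃ x₄))
  W⁴-expand a = begin
    Wₐ *ᶜ (Wₐ *ᶜ (Wₐ *ᶜ Wₐ))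
      ≈⟨ *ᶜ-congˡ≗ Wₐ (*ᶜ-congˡ≗ Wₐ (∑Ψ-* (h a) Wₐ _ (λ x₃ → Ψ-*-∑ (h a x₃) (h a)))) ⟩
    Wₐ *ᶜ (Wₐ *ᶜ ∑ (λ x₃ → ∑ λ x₄ → Ψ (h a x₃ + h a x₄)))
      ≈⟨ *ᶜ-congˡ≗ Wₐ (∑Ψ-* (h a) _ _ (λ x₂ → Ψ-*-∑∑ (h a x₂) (λ x₃ x₄ → h a x₃ + h a x₄))) ⟩
    Wₐ *ᶜ ∑³ (λ x₂ x₃ x₄ → Ψ (h a x₂ + (h a x₃ + h a x₄)))
      ≈⟨ ∑Ψ-* (h a) _ _ (λ x₁ → Ψ-*-∑³ (h a x₁) (λ x₂ x₃ x₄ → h a x₂ + (h a x₃ + h a x₄))) ⟩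
    ∑⁴ (λ x₁ x₂ x₃ x₄ → Ψ (h a x₁ + (h a x₂ + (h a x₃ + h a x₄))))
      ≈⟨ ∑⁴-cong (λ x₁ x₂ x₃ x₄ k → trans (cong (λ t → Ψ t k) (Σh≡D+as x₁ x₂ x₃ x₄)) (Ψ-+ _ _ k)) ⟩
    ∑⁴ (λ x₁ x₂ x₃ x₄ → Ψ (D x₁ x₂ x₃ x₄) *ᶜ Ψ (a * s x₁ x₂ x₃ x₄))
      ∎
    where
    open ≗-Reasoning
    Wₐ = W F p n d a
    Σh≡D+as : ∀ x₁ x₂ x₃ x₄ → h a x₁ + (h a x₂ + (h a x₃ + h a x₄)) ≡ D x₁ x₂ x₃ x₄ + a * s x₁ x₂ x₃ x₄
    Σh≡D+as x₁ x₂ x₃ x₄ = solve 9 (λ a x₁ x₂ x₃ x₄ y₁ y₂ y₃ y₄ →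
      (y₁ :- a :* x₁) :+ ((y₂ :- a :* x₂) :+ ((y₃ :- a :* x₃) :+ (y₄ :- a :* x₄)))
        := (y₁ :+ (y₂ :+ (y₃ :+ y₄))) :+ a :* (:- (x₁ :+ (x₂ :+ (x₃ :+ x₄)))))
      refl a x₁ x₂ x₃ x₄ (x₁ ^ d) (x₂ ^ d) (x₃ ^ d) (x₄ ^ d)

  D₃ : K → K → K → K
  D₃ x₁ x₂ x₃ = D x₁ x₂ x₃ (- (x₁ + (x₂ + x₃)))

  -- Only x₄ = -(x₁ + x₂ + x₃) survives the sum over a.
  ∑ₐ-collapse : ∀ x₁ x₂ x₃ → ∑ (λ x₄ → Ψ (D x₁ x₂ x₃ x₄) *ᶜ ∑ (λ a → Ψ (a * s x₁ x₂ x₃ x₄)))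
                              ≈ size ·ᶜ Ψ (D₃ x₁ x₂ x₃)
  ∑ₐ-collapse x₁ x₂ x₃ = ≈-trans (sumᶜ-single unique (complete w) off) (≗⇒≈ on-w)
    where
    w = - (x₁ + (x₂ + x₃))
    s≡0⇒x₄≡w : ∀ x₄ → s x₁ x₂ x₃ x₄ ≡ 0# → x₄ ≡ w
    s≡0⇒x₄≡w x₄ s≡0 = begin
      x₄
        ≡⟨ solve 4 (λ x₁ x₂ x₃ x₄ → x₄ := :- (x₁ :+ (x₂ :+ x₃)) :- :- (x₁ :+ (x₂ :+ (x₃ :+ x₄)))) refl x₁ x₂ x₃ x₄ ⟩
      w - s x₁ x₂ x₃ x₄
        ≡⟨ cong (λ t → w - t) s≡0 ⟩
      w - 0#
        ≡⟨ cong (w +_) -0#≈0# ⟩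
      w + 0#
        ≡⟨ +-identityʳ w ⟩
      w
        ∎
      where open ≡-Reasoning
    off : ∀ x₄ → x₄ ∈ elements → x₄ ≢ w → Ψ (D x₁ x₂ x₃ x₄) *ᶜ ∑ (λ a → Ψ (a * s x₁ x₂ x₃ x₄)) ≈ 0ᶜ
    off x₄ _ x₄≢w = v≈0⇒u*v≈0 (Ψ (D x₁ x₂ x₃ x₄)) (orthogonality (s x₁ x₂ x₃ x₄) (x₄≢w ∘ s≡0⇒x₄≡w x₄))
    s≡0 : s x₁ x₂ x₃ w ≡ 0#
    s≡0 = solve 3 (λ x₁ x₂ x₃ → :- (x₁ :+ (x₂ :+ (x₃ :+ :- (x₁ :+ (x₂ :+ x₃))))) := con (ℤ.+ 0)) refl x₁ x₂ x₃
    on-w : Ψ (D₃ x₁ x₂ x₃) *ᶜ ∑ (λ a → Ψ (a * s x₁ x₂ x₃ w)) ≗ size ·ᶜ Ψ (D₃ x₁ x₂ x₃)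
    on-w = begin
      Ψ (D₃ x₁ x₂ x₃) *ᶜ ∑ (λ a → Ψ (a * s x₁ x₂ x₃ w))
        ≈⟨ *ᶜ-congˡ≗ (Ψ (D₃ x₁ x₂ x₃)) (λ k → cong (λ t → ∑ (λ a → Ψ (a * t)) k) s≡0) ⟩
      Ψ (D₃ x₁ x₂ x₃) *ᶜ ∑ (λ a → Ψ (a * 0#))
        ≈⟨ *ᶜ-congˡ≗ (Ψ (D₃ x₁ x₂ x₃)) orthogonality-0# ⟩
      Ψ (D₃ x₁ x₂ x₃) *ᶜ (size ·ᶜ ε 0)
        ≈⟨ *ᶜ-·ᶜ size (Ψ (D₃ x₁ x₂ x₃)) (ε 0) ⟩
      size ·ᶜ (Ψ (D₃ x₁ x₂ x₃) *ᶜ ε 0)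
        ≈⟨ (λ k → cong ((ℤ.+ size) ℤ.*_) (trans (ε-+ (τ (D₃ x₁ x₂ x₃)) 0 k) (ε-cong (cong (_% p) (ℕ.+-identityʳ _)) k))) ⟩
      size ·ᶜ Ψ (D₃ x₁ x₂ x₃)
        ∎
      where open ≗-Reasoning

  ∑W⁴≈q∑Ψ[D₃] : ∑ (λ a → W F p n d a ^4) ≈ size ·ᶜ ∑³ (λ x₁ x₂ x₃ → Ψ (D₃ x₁ x₂ x₃))
  ∑W⁴≈q∑Ψ[D₃] = begin
    ∑ (λ a → W F p n d a ^4)
      ≈⟨ ≗⇒≈ (sumᶜ-cong elements W⁴-expand) ⟩
    ∑ (λ a → ∑⁴ (λ x₁ x₂ x₃ x₄ → Ψ (D x₁ x₂ x₃ x₄) *ᶜ Ψ (a * s x₁ x₂ x₃ x₄)))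
      ≈⟨ ≗⇒≈ (∑-pull-out⁴ (λ a x₁ x₂ x₃ x₄ → Ψ (D x₁ x₂ x₃ x₄) *ᶜ Ψ (a * s x₁ x₂ x₃ x₄))) ⟩
    ∑⁴ (λ x₁ x₂ x₃ x₄ → ∑ (λ a → Ψ (D x₁ x₂ x₃ x₄) *ᶜ Ψ (a * s x₁ x₂ x₃ x₄)))
      ≈⟨ ≗⇒≈ (∑⁴-cong (λ x₁ x₂ x₃ x₄ → *ᶜ-sumᶜʳ (Ψ (D x₁ x₂ x₃ x₄)) _ elements)) ⟨
    ∑³ (λ x₁ x₂ x₃ → ∑ (λ x₄ → Ψ (D x₁ x₂ x₃ x₄) *ᶜ ∑ (λ a → Ψ (a * s x₁ x₂ x₃ x₄))))
      ≈⟨ ∑³-cong≈ ∑ₐ-collapse ⟩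
    ∑³ (λ x₁ x₂ x₃ → size ·ᶜ Ψ (D₃ x₁ x₂ x₃))
      ≈⟨ ≗⇒≈ (·ᶜ-∑³ size (λ x₁ x₂ x₃ → Ψ (D₃ x₁ x₂ x₃))) ⟨
    size ·ᶜ ∑³ (λ x₁ x₂ x₃ → Ψ (D₃ x₁ x₂ x₃))
      ∎
    where open ≈-Reasoning

  P : K → K → K → K
  P x y z = bar F p r x * y * z + x * bar F p r y * z + x * y * bar F p r z

  σ : K → K → K
  σ z v = (- z) - v

  σ-involutive : ∀ z v → σ z (σ z v) ≡ v
  σ-involutive z v = solve 2 (λ z v → (:- z) :- ((:- z) :- v) := v) refl z v

  -- In the variables x₁ = z, x₂ = σ z x, x₃ = σ z y, each term x^d = x² x̄, and x ↦ x̄ is additive.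
  D₃∘σ≡ΣP : ∀ x y z → D₃ z (σ z x) (σ z y) ≡ P x y x + (P x y y + (P x y z + P x y z))
  D₃∘σ≡ΣP x y z = begin
    E (B (σ z x)) (B (σ z y)) (B w)
      ≡⟨ cong₂ (λ s t → E s t (B w)) (Bσ x) (Bσ y) ⟩
    E (- B z + - B x) (- B z + - B y) (B w)
      ≡⟨ cong (E (- B z + - B x) (- B z + - B y)) Bw ⟩
    E (- B z + - B x) (- B z + - B y) (- (B z + ((- B z + - B x) + (- B z + - B y))))
      ≡⟨ solve 6 (λ x y z X Y Z →
           let x₂ = (:- z) :- x
               x₃ = (:- z) :- y
               x₄ = :- (z :+ (x₂ :+ x₃))
               X₂ = (:- Z) :+ (:- X)
               X₃ = (:- Z) :+ (:- Y)
               X₄ = :- (Z :+ (X₂ :+ X₃))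
           in z :* (z :* Z) :+ (x₂ :* (x₂ :* X₂) :+ (x₃ :* (x₃ :* X₃) :+ x₄ :* (x₄ :* X₄)))
              := (X :* y :* x :+ x :* Y :* x :+ x :* y :* X) :+ ((X :* y :* y :+ x :* Y :* y :+ x :* y :* Y)
                   :+ ((X :* y :* z :+ x :* Y :* z :+ x :* y :* Z) :+ (X :* y :* z :+ x :* Y :* z :+ x :* y :* Z))))
           refl x y z (B x) (B y) (B z) ⟩
    P x y x + (P x y y + (P x y z + P x y z))
      ∎
    where
    open ≡-Reasoning
    B = bar F p r
    w = - (z + (σ z x + σ z y))
    E : K → K → K → K
    E s t u = z * (z * B z) + (σ z x * (σ z x * s) + (σ z y * (σ z y * t) + w * (w * u)))
    Bσ : ∀ v → B (σ z v) ≡ - B z + - B v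
    Bσ v = trans (frobeniusⁱ r (- z) (- v)) (cong₂ _+_ (frobeniusⁱ-neg r z) (frobeniusⁱ-neg r v))
    Bw : B w ≡ - (B z + ((- B z + - B x) + (- B z + - B y)))
    Bw = trans (frobeniusⁱ-neg r _) (cong -_ (trans (frobeniusⁱ r z _)
           (cong (B z +_) (trans (frobeniusⁱ r (σ z x) (σ z y)) (cong₂ _+_ (Bσ x) (Bσ y))))))

  τ-ΣP : ∀ a b c → τ (a + (b + (c + c))) % p ≡ (τ a ℕ.+ τ b ℕ.+ 2 ℕ.* τ c) % p
  τ-ΣP a b c = ×1≡⇒%≡ _ _ (begin
    τ (a + (b + (c + c))) ×1
      ≡⟨ τ-×1 _ ⟩
    tr (a + (b + (c + c)))
      ≡⟨ trans (tr-+ a _) (cong (tr a +_) (trans (tr-+ b _) (cong (tr b +_) (tr-+ c c)))) ⟩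
    tr a + (tr b + (tr c + tr c))
      ≡⟨ cong₂ _+_ (τ-×1 a) (cong₂ _+_ (τ-×1 b) (cong₂ _+_ (τ-×1 c) (τ-×1 c))) ⟨
    τ a ×1 + (τ b ×1 + (τ c ×1 + τ c ×1))
      ≡⟨ cong (λ t → τ a ×1 + (τ b ×1 + t)) (×1-homo-+ (τ c) (τ c)) ⟨
    τ a ×1 + (τ b ×1 + (τ c ℕ.+ τ c) ×1)
      ≡⟨ cong (τ a ×1 +_) (×1-homo-+ (τ b) _) ⟨
    τ a ×1 + (τ b ℕ.+ (τ c ℕ.+ τ c)) ×1
      ≡⟨ ×1-homo-+ (τ a) _ ⟨
    (τ a ℕ.+ (τ b ℕ.+ (τ c ℕ.+ τ c))) ×1
      ≡⟨ cong _×1 (trans (sym (ℕ.+-assoc (τ a) (τ b) _)) (cong (λ t → τ a ℕ.+ τ b ℕ.+ (τ c ℕ.+ t)) (sym (ℕ.+-identityʳ (τ c))))) ⟩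
    (τ a ℕ.+ τ b ℕ.+ 2 ℕ.* τ c) ×1
      ∎)
    where open ≡-Reasoning

  ∑³Ψ[D₃]≗∑³ε[T] : ∑³ (λ x₁ x₂ x₃ → Ψ (D₃ x₁ x₂ x₃))
                   ≗ ∑³ (λ x y z → ε (toℕ (T F p n r x y x) ℕ.+ toℕ (T F p n r x y y) ℕ.+ 2 ℕ.* toℕ (T F p n r x y z)))
  ∑³Ψ[D₃]≗∑³ε[T] = begin
    ∑³ (λ x₁ x₂ x₃ → Ψ (D₃ x₁ x₂ x₃))
      ≈⟨ sumᶜ-cong elements (λ z → ∑-permute (σ z) (σ z) (σ-involutive z) (σ-involutive z) (λ x₂ → ∑ λ x₃ → Ψ (D₃ z x₂ x₃))) ⟨
    ∑ (λ z → ∑ λ x → ∑ λ x₃ → Ψ (D₃ z (σ z x) x₃))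
      ≈⟨ sumᶜ-cong elements (λ z → sumᶜ-cong elements λ x →
           ∑-permute (σ z) (σ z) (σ-involutive z) (σ-involutive z) (λ x₃ → Ψ (D₃ z (σ z x) x₃))) ⟨
    ∑ (λ z → ∑ λ x → ∑ λ y → Ψ (D₃ z (σ z x) (σ z y)))
      ≈⟨ sumᶜ-swap (λ z x → ∑ λ y → Ψ (D₃ z (σ z x) (σ z y))) elements elements ⟩
    ∑ (λ x → ∑ λ z → ∑ λ y → Ψ (D₃ z (σ z x) (σ z y)))
      ≈⟨ sumᶜ-cong elements (λ x → sumᶜ-swap (λ z y → Ψ (D₃ z (σ z x) (σ z y))) elements elements) ⟩
    ∑³ (λ x y z → Ψ (D₃ z (σ z x) (σ z y)))
      ≈⟨ ∑³-cong (λ x y z k → trans (cong (λ t → Ψ t k) (D₃∘σ≡ΣP x y z)) (ε-cong (τ-ΣP (P x y x) (P x y y) (P x y z)) k)) ⟩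
    ∑³ (λ x y z → ε (toℕ (T F p n r x y x) ℕ.+ toℕ (T F p n r x y y) ℕ.+ 2 ℕ.* toℕ (T F p n r x y z)))
      ∎
    where open ≗-Reasoning

-- Opened only here: in the modules above, _+_, _*_ and _^_ are the field operations.
open import Data.Nat using (_+_; _*_; _^_)

lemma3p1 : (F : FiniteField) (p n r : ℕ) {{pp : Prime p}} →
    HasChar F p →
    card F ≡ p ^ n →
    gcd (2 + p ^ r) (p ^ n ∸ 1) ≡ 1 →
    sumᶜ (λ a → (W F p n (2 + p ^ r) a) ^4) (elemsˣ F)
      ≈ᶜ
    (card F ·ᶜ sumᶜ (λ x → sumᶜ (λ y → sumᶜ (λ z →
        ε (toℕ (T F p n r x y x) + toℕ (T F p n r x y y) + 2 * toℕ (T F p n r x y z)))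
        (elems F)) (elems F)) (elems F))
lemma3p1 F p n r char card≡pⁿ d-coprime =
  ≈⇒≈ᶜ (≈-trans ∑ˣW⁴≈∑W⁴ (≈-trans ∑W⁴≈q∑Ψ[D₃] (·ᶜ-cong (card F) (≗⇒≈ ∑³Ψ[D₃]≗∑³ε[T]))))
  where
  open Cyclotomic p
  open FourthMoment F p n r char card≡pⁿ d-coprime
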